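{- Let $H$ be a graph and $W\subseteq V(H)$ nonempty. Then $\gamma(H)\ge \varepsilon(H,W)\cdot|W|^2/108$.
   Context: For $u,v\in V(H)$, let $\mathcal P_H(u,v)$ be the set of paths from $u$ to $v$ in $H$ (for $u=v$ it contains only the one-vertex path $(u)$). $\varepsilon(H,W)$ is the optimal value of the LP: maximize $\varepsilon$ subject to $\sum_{p\in\mathcal P_H(u,v)}x_p\ge\varepsilon$ for all $u,v\in W$; $\sum_{u,v\in W}\sum_{p\in\mathcal P_H(u,v),\,w\in p}x_p\le 1$ for all $w\in V(H)$; $x_p\ge0$ for all $u,v\in W$, $p\in\mathcal P_H(u,v)$. The blowup $H\otimes J_t$ has vertices $v^{(i)}$ ($v\in V(H)$, $i\in[t]$) and edges $u^{(i)}v^{(j)}$ for $uv\in E(H)$, $i,j\in[t]$, and $u^{(i)}u^{(j)}$ for $u\in V(H)$, $i\ne j$. A matching on a vertex set $X$ is a set of pairwise disjoint pairs $\{u,v\}$, $u\ne v$, $u,v\in X$ (not necessarily edges). For a graph $H'$ and a matching $M$ with endpoints in $V(H')$, an uncongested $M$-linkage is a family of pairwise vertex-disjoint paths $P_{uv}$ in $H'$, one for each $\{u,v\}\in M$, with endpoints $u,v$. $X\subseteq V(H')$ is matching-linked if an uncongested $M$-linkage exists for every matching $M$ on $X$. The linkage capacity $\gamma(H)$ is the supremum of all $c>0$ such that for all sufficiently large $t$, $H\otimes J_t$ contains a matching-linked set of size $\lfloor ct\rfloor$.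
   Formalization: The LP variables $x_p$ and the objective value $\varepsilon$ are taken over the rationals, and so are the constants c in the supremum defining $\gamma(H)$. -}

module Defs where

open import Data.Nat using (ℕ)
open import Data.Bool using (Bool; true; false; _∧_; _∨_; not)
open import Data.Fin using (Fin)
open import Data.Fin.Properties using (_≟_)
open import Data.Fin.Subset using (Subset; _∈_)
open import Data.List using (List; []; _∷_; map; foldr; filterᵇ; concat; length)
open import Data.Bool.ListAction using (any)
open import Data.List.Relation.Unary.All using (All)
open import Data.List.Relation.Unary.Unique.Propositional using (Unique)
open import Data.List.Relation.Binary.Pointwise using (Pointwise)
open import Data.Product using (_×_; _,_; Σ; proj₁; proj₂)
open import Data.Rational using (ℚ; 0ℚ; 1ℚ; _≤_; _+_)
open import Data.Integer using (ℤ)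
open import Relation.Nullary using (¬_)
open import Relation.Nullary.Decidable using (isYes)
open import Relation.Binary.PropositionalEquality using (_≡_)

Adj : ℕ → Set
Adj n = Fin n → Fin n → Bool

IsSimple : {n : ℕ} → Adj n → Set
IsSimple {n} adj = ((u v : Fin n) → adj u v ≡ adj v u) × ((u : Fin n) → adj u u ≡ false)

data Walk {V : Set} (adj : V → V → Bool) : V → V → List V → Set where
  single : (u : V) → Walk adj u u (u ∷ [])
  step   : {u w v : V} {vs : List V} → adj u w ≡ true → Walk adj w v vs → Walk adj u v (u ∷ vs)

-- A path from u to v: a walk with pairwise distinct vertices.
-- (For u = v the only path is the one-vertex path (u).)
IsPath : {V : Set} (adj : V → V → Bool) → V → V → List V → Set
IsPath adj u v vs = Walk adj u v vs × Unique vs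

-- The LP defining ε(H,W), with finitely supported x.
-- A weighted path: (source, target, vertex list, weight x_p).

record WPath (n : ℕ) : Set where
  constructor wpath
  field
    src tgt : Fin n
    verts   : List (Fin n)
    weight  : ℚ
open WPath public

sumℚ : List ℚ → ℚ
sumℚ = foldr _+_ 0ℚ

eqᵇ : {n : ℕ} → Fin n → Fin n → Bool
eqᵇ u v = isYes (u ≟ v)

flowBetween : {n : ℕ} → List (WPath n) → Fin n → Fin n → ℚ
flowBetween xs u v = sumℚ (map weight (filterᵇ (λ p → eqᵇ (src p) u ∧ eqᵇ (tgt p) v) xs))

-- Σ_{u,v ∈ W} Σ_{p ∈ P_H(u,v), w ∈ p} x_p   (all entries have endpoints in W)
load : {n : ℕ} → List (WPath n) → Fin n → ℚ
load xs w = sumℚ (map weight (filterᵇ (λ p → any (eqᵇ w) (verts p)) xs))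

-- xs is a (finitely supported) feasible solution of the LP for ε(H,W) with objective value e:
-- xs lists distinct paths p ∈ P_H(u,v) (u,v ∈ W) with their values x_p ≥ 0 (all other x_p = 0).
Feasible : {n : ℕ} → Adj n → Subset n → List (WPath n) → ℚ → Set
Feasible {n} adj W xs e =
  All (λ p → IsPath adj (src p) (tgt p) (verts p) × src p ∈ W × tgt p ∈ W × 0ℚ ≤ weight p) xs
  × Unique (map (λ p → (src p , tgt p , verts p)) xs)
  × ((u v : Fin n) → u ∈ W → v ∈ W → e ≤ flowBetween xs u v)
  × ((w : Fin n) → load xs w ≤ 1ℚ)

blowAdj : {n t : ℕ} → Adj n → Fin n × Fin t → Fin n × Fin t → Bool
blowAdj adj (u , i) (v , j) = adj u v ∨ (eqᵇ u v ∧ not (eqᵇ i j))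

IsMatchingOn : {V : Set} → List V → List (V × V) → Set
IsMatchingOn X M =
  All (λ ab → ¬ (proj₁ ab ≡ proj₂ ab) × proj₁ ab Data.List.Membership.Propositional.∈ X × proj₂ ab Data.List.Membership.Propositional.∈ X) M
  × Unique (concat (map (λ ab → proj₁ ab ∷ proj₂ ab ∷ []) M))
  where import Data.List.Membership.Propositional

UncongestedLinkage : {V : Set} → (V → V → Bool) → List (V × V) → Set
UncongestedLinkage {V} adj M =
  Σ (List (List V)) λ ps →
    Pointwise (λ ab vs → IsPath adj (proj₁ ab) (proj₂ ab) vs) M ps
    × Unique (concat ps)

MatchingLinked : {V : Set} → (V → V → Bool) → List V → Set
MatchingLinked {V} adj X =
  Unique X × ((M : List (V × V)) → IsMatchingOn X M → UncongestedLinkage adj M)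

-- Clearing denominators turns the LP solution into paths with integer multiplicities κ p such that
-- at most Q of them (counted with multiplicity) pass through any vertex, and at least Q e of them
-- run from x to w for all x, w ∈ W.  Take every path r κ p times.  No vertex then lies on more
-- than r Q ≤ t - s copies, so the k-th copy through z can use layer s + k of the fibre of z.  This
-- embeds all copies vertex-disjointly into the layers s, …, t - 1 of H ⊗ J_t and gives, for each
-- ordered pair x, w ∈ W, at least L tracks from the fibre of x to the fibre of w.
--
-- The linked set X consists of ⌊c t⌋ vertices of W × {0, …, s - 1}.  A matching pair (a, b) whose
-- ends have the same type is joined inside their fibre.  Otherwise it is routed greedily along an
-- unused track from the type of a to a colour w, across the fibre of w, and back along an unused
-- track from the type of b to w.  A type has at most s endpoints, so at most s tracks leaving it
-- are ever used; since 2 s < |W| L, some colour always has unused tracks from both types.  The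
-- hypothesis c < e |W|² / 108 leaves enough room to choose s ≈ c t / |W|, L ≈ 2 s / |W| and
-- r ≈ t / Q with L ≤ r Q e.

module Submission where

module Lists where

  open import Data.Bool using (Bool; true; false; _∧_)
  open import Data.Fin using (Fin; zero; suc)
  open import Data.Fin.Properties using (pigeonhole; _≟_) renaming (<⇒≢ to <⇒≢ᶠ)
  open import Data.List using (List; []; _∷_; _++_; map; length; lookup; take; filterᵇ; replicate; cartesianProduct)
  open import Data.List.Membership.Propositional using (_∈_)
  open import Data.List.Membership.Propositional.Properties using (∈-lookup)
  open import Data.List.Properties using (length-map; length-++)
  open import Data.List.Membership.Setoid.Properties using (index-injective)
  open import Data.List.Relation.Binary.Disjoint.Propositional using (Disjoint)
  open import Data.List.Relation.Binary.Subset.Propositional using (_⊆_)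
  open import Data.List.Relation.Unary.All as All using (All; []; _∷_)
  open import Data.List.Relation.Unary.AllPairs using (AllPairs; []; _∷_)
  open import Data.List.Relation.Unary.Any using (here; there; index)
  open import Data.List.Relation.Unary.Unique.Propositional using (Unique)
  open import Data.Nat using (ℕ; zero; suc; _+_; _*_; _≤_; _<_; _≤?_; z≤n; s≤s; NonZero)
  open import Data.Nat.Properties hiding (_≟_)
  open import Data.Nat.Solver using (module +-*-Solver)
  open import Data.Product using (∃; _,_)
  open import Function using (_∘_)
  open import Relation.Binary.PropositionalEquality
  open import Relation.Binary.PropositionalEquality.Properties using (setoid)
  open import Relation.Nullary using (yes; no; contradiction)
  open import Defs using (eqᵇ)

  private
    variable
      A B : Set

  eqᵇ-refl : ∀ {n} (u : Fin n) → eqᵇ u u ≡ true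
  eqᵇ-refl u with u ≟ u
  ... | yes _   = refl
  ... | no u≢u  = contradiction refl u≢u

  eqᵇ⇒≡ : ∀ {n} {u v : Fin n} → eqᵇ u v ≡ true → u ≡ v
  eqᵇ⇒≡ {u = u} {v} eq with u ≟ v
  ... | yes u≡v = u≡v

  ≢⇒eqᵇ≡false : ∀ {n} {u v : Fin n} → u ≢ v → eqᵇ u v ≡ false
  ≢⇒eqᵇ≡false {u = u} {v} u≢v with u ≟ v
  ... | yes u≡v = contradiction u≡v u≢v
  ... | no _    = refl

  eqᵇ-sym : ∀ {n} (u v : Fin n) → eqᵇ u v ≡ eqᵇ v u
  eqᵇ-sym u v with u ≟ v | v ≟ u
  ... | yes _   | yes _   = refl
  ... | no _    | no _    = refl
  ... | yes u≡v | no v≢u  = contradiction (sym u≡v) v≢u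
  ... | no u≢v  | yes v≡u = contradiction (sym v≡u) u≢v

  ind : Bool → ℕ
  ind true  = 1
  ind false = 0

  count : (A → Bool) → List A → ℕ
  count p []       = 0
  count p (a ∷ as) = ind (p a) + count p as

  sumOver : List A → (A → ℕ) → ℕ
  sumOver []       f = 0
  sumOver (a ∷ as) f = f a + sumOver as f

  count-++ : (p : A → Bool) (as bs : List A) → count p (as ++ bs) ≡ count p as + count p bs
  count-++ p []       bs = refl
  count-++ p (a ∷ as) bs = trans (cong (ind (p a) +_) (count-++ p as bs)) (sym (+-assoc (ind (p a)) _ _))

  count-replicate : (p : A → Bool) (k : ℕ) (a : A) → count p (replicate k a) ≡ ind (p a) * k
  count-replicate p zero    a = sym (*-zeroʳ (ind (p a)))
  count-replicate p (suc k) a = trans (cong (ind (p a) +_) (count-replicate p k a)) (sym (*-suc (ind (p a)) k))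

  length-filterᵇ : (p : A → Bool) (as : List A) → length (filterᵇ p as) ≡ count p as
  length-filterᵇ p []       = refl
  length-filterᵇ p (a ∷ as) with p a
  ... | true  = cong suc (length-filterᵇ p as)
  ... | false = length-filterᵇ p as

  sumOver-zero : (as : List A) → sumOver as (λ _ → 0) ≡ 0
  sumOver-zero []       = refl
  sumOver-zero (a ∷ as) = sumOver-zero as

  sumOver-+ : (as : List A) (f g : A → ℕ) →
              sumOver as (λ a → f a + g a) ≡ sumOver as f + sumOver as g
  sumOver-+ []       f g = refl
  sumOver-+ (a ∷ as) f g = begin
    f a + g a + sumOver as (λ a → f a + g a)    ≡⟨ cong (f a + g a +_) (sumOver-+ as f g) ⟩
    f a + g a + (sumOver as f + sumOver as g)   ≡⟨ solve 4 (λ x y u v → x :+ y :+ (u :+ v) := x :+ u :+ (y :+ v))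
                                                         refl (f a) (g a) (sumOver as f) (sumOver as g) ⟩
    f a + sumOver as f + (g a + sumOver as g)   ∎
    where
    open ≡-Reasoning
    open +-*-Solver

  sumOver-*ʳ : (as : List A) (f : A → ℕ) (k : ℕ) → sumOver as (λ a → f a * k) ≡ sumOver as f * k
  sumOver-*ʳ []       f k = refl
  sumOver-*ʳ (a ∷ as) f k = trans (cong (f a * k +_) (sumOver-*ʳ as f k)) (sym (*-distribʳ-+ k (f a) _))

  sumOver-mono : (as : List A) {f g : A → ℕ} → (∀ {a} → a ∈ as → f a ≤ g a) →
                 sumOver as f ≤ sumOver as g
  sumOver-mono []       f≤g = z≤n
  sumOver-mono (a ∷ as) f≤g = +-mono-≤ (f≤g (here refl)) (sumOver-mono as (f≤g ∘ there))

  sumOver-swap : (as : List A) (bs : List B) (f : A → B → ℕ) →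
                 sumOver as (λ a → sumOver bs (f a)) ≡ sumOver bs (λ b → sumOver as (λ a → f a b))
  sumOver-swap []       bs f = sym (sumOver-zero bs)
  sumOver-swap (a ∷ as) bs f = trans (cong (sumOver bs (f a) +_) (sumOver-swap as bs f))
                                     (sym (sumOver-+ bs (f a) (λ b → sumOver as (λ a → f a b))))

  length*≤sumOver : (as : List A) {k : ℕ} {f : A → ℕ} → (∀ {a} → a ∈ as → k ≤ f a) →
                    length as * k ≤ sumOver as f
  length*≤sumOver []       k≤f = z≤n
  length*≤sumOver (a ∷ as) k≤f = +-mono-≤ (k≤f (here refl)) (length*≤sumOver as (k≤f ∘ there))

  sumOver-eqᵇ-∉ : ∀ {n} {v : Fin n} {ws : List (Fin n)} → All (v ≢_) ws →
                  sumOver ws (λ w → ind (eqᵇ v w)) ≡ 0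
  sumOver-eqᵇ-∉ []            = refl
  sumOver-eqᵇ-∉ (v≢w ∷ v∉ws) rewrite ≢⇒eqᵇ≡false v≢w = sumOver-eqᵇ-∉ v∉ws

  sumOver-eqᵇ : ∀ {n} {ws : List (Fin n)} → Unique ws → (b : Bool) (v : Fin n) →
                sumOver ws (λ w → ind (b ∧ eqᵇ v w)) ≤ ind b
  sumOver-eqᵇ {ws = ws}     _            false v = ≤-reflexive (sumOver-zero ws)
  sumOver-eqᵇ {ws = []}     _            true  v = z≤n
  sumOver-eqᵇ {ws = w ∷ ws} (w∉ws ∷ ws!) true  v with v ≟ w
  ... | no _     = sumOver-eqᵇ ws! true v
  ... | yes refl rewrite sumOver-eqᵇ-∉ w∉ws = ≤-refl

  lookup-injective : {as : List A} → Unique as → ∀ {i j} → lookup as i ≡ lookup as j → i ≡ j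
  lookup-injective (a∉as ∷ as!) {zero}  {zero}  eq = refl
  lookup-injective (a∉as ∷ as!) {zero}  {suc j} eq = contradiction eq (All.lookup a∉as (∈-lookup j))
  lookup-injective (a∉as ∷ as!) {suc i} {zero}  eq = contradiction (sym eq) (All.lookup a∉as (∈-lookup i))
  lookup-injective (a∉as ∷ as!) {suc i} {suc j} eq = cong suc (lookup-injective as! eq)

  Unique⇒length-mono-⊆ : {as bs : List A} → Unique as → as ⊆ bs → length as ≤ length bs
  Unique⇒length-mono-⊆ {as = as} {bs} as! as⊆bs with length as ≤? length bs
  ... | yes ≤ = ≤
  ... | no ≰ with i , j , i<j , same ← pigeonhole (≰⇒> ≰) (λ k → index (as⊆bs (∈-lookup k)))
    = contradiction (lookup-injective as! (index-injective (setoid _) (as⊆bs (∈-lookup i)) (as⊆bs (∈-lookup j)) same))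
                    (<⇒≢ᶠ i<j)

  nthOr : A → List A → ℕ → A
  nthOr d []       k       = d
  nthOr d (a ∷ as) zero    = a
  nthOr d (a ∷ as) (suc k) = nthOr d as k

  nthOr-∈ : (d : A) (as : List A) {k : ℕ} → k < length as → nthOr d as k ∈ as
  nthOr-∈ d (a ∷ as) {zero}  _         = here refl
  nthOr-∈ d (a ∷ as) {suc k} (s≤s k<) = there (nthOr-∈ d as k<)

  nthOr-injective : (d : A) {as : List A} → Unique as → ∀ {j k} → j < length as → k < length as →
                    nthOr d as j ≡ nthOr d as k → j ≡ k
  nthOr-injective d {a ∷ as} _          {zero}  {zero}  _        _        _  = refl
  nthOr-injective d {a ∷ as} (a∉as ∷ _) {zero}  {suc k} _        (s≤s k<) eq =
    contradiction eq (All.lookup a∉as (nthOr-∈ d as k<))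
  nthOr-injective d {a ∷ as} (a∉as ∷ _) {suc j} {zero}  (s≤s j<) _        eq =
    contradiction (sym eq) (All.lookup a∉as (nthOr-∈ d as j<))
  nthOr-injective d {a ∷ as} (_ ∷ as!)  {suc j} {suc k} (s≤s j<) (s≤s k<) eq =
    cong suc (nthOr-injective d as! j< k< eq)

  disjoint⇒Unique : {xss : List (List A)} → AllPairs Disjoint xss → All (λ xs → ∃ (_∈ xs)) xss →
                    Unique xss
  disjoint⇒Unique []         []                  = []
  disjoint⇒Unique (d ∷ ds)  ((x , x∈xs) ∷ ne)  =
    All.map (λ disj xs≡ys → disj (x∈xs , subst (x ∈_) xs≡ys x∈xs)) d ∷ disjoint⇒Unique ds ne

  length-cartesianProduct : (as : List A) (bs : List B) →
                            length (cartesianProduct as bs) ≡ length as * length bs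
  length-cartesianProduct []       bs = refl
  length-cartesianProduct (a ∷ as) bs = begin
    length (map (a ,_) bs ++ cartesianProduct as bs)
      ≡⟨ length-++ (map (a ,_) bs) ⟩
    length (map (a ,_) bs) + length (cartesianProduct as bs)
      ≡⟨ cong₂ _+_ (length-map (a ,_) bs) (length-cartesianProduct as bs) ⟩
    length bs + length as * length bs
      ∎
    where open ≡-Reasoning

  ∈-take⁻ : ∀ k (as : List A) {a} → a ∈ take k as → a ∈ as
  ∈-take⁻ (suc k) (a ∷ as) (here refl) = here refl
  ∈-take⁻ (suc k) (a ∷ as) (there a∈)  = there (∈-take⁻ k as a∈)

  ∈⇒length≢0 : ∀ {a : A} {as} → a ∈ as → NonZero (length as)
  ∈⇒length≢0 (here _)  = _
  ∈⇒length≢0 (there _) = _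

module Graphs where

  open import Data.Bool using (Bool; true; _∧_; _∨_)
  open import Data.Bool.ListAction using (any)
  open import Data.Bool.Properties using (∨-zeroʳ)
  open import Data.Fin using (Fin)
  open import Data.List using (List; _∷_; _++_; map; reverse)
  open import Data.List.Membership.Propositional using (_∈_)
  open import Data.List.Properties using (unfold-reverse)
  open import Data.List.Relation.Binary.Permutation.Setoid using (↭-sym)
  open import Data.List.Relation.Binary.Permutation.Setoid.Properties using (Unique-resp-↭; ↭-reverse)
  open import Data.List.Relation.Unary.Any using (here; there)
  open import Data.List.Relation.Unary.Unique.Propositional using (Unique)
  open import Data.Nat using (ℕ)
  open import Data.Product using (_×_; _,_)
  open import Relation.Binary.PropositionalEquality
  open import Relation.Binary.PropositionalEquality.Properties using (setoid)
  open import Defs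
  open Lists using (eqᵇ-refl; eqᵇ⇒≡; ≢⇒eqᵇ≡false; eqᵇ-sym)

  through : ∀ {n} → Fin n → WPath n → Bool
  through z p = any (eqᵇ z) (verts p)

  joins : ∀ {n} → Fin n → Fin n → WPath n → Bool
  joins x w p = eqᵇ (src p) x ∧ eqᵇ (tgt p) w

  through-∈ : ∀ {n} {z : Fin n} {p} → z ∈ verts p → through z p ≡ true
  through-∈ {p = p} = any-eqᵇ (verts p)
    where
    any-eqᵇ : ∀ {n} {z : Fin n} vs → z ∈ vs → any (eqᵇ z) vs ≡ true
    any-eqᵇ {z = z} (_ ∷ _)  (here refl) rewrite eqᵇ-refl z = refl
    any-eqᵇ         (_ ∷ vs) (there z∈)  rewrite any-eqᵇ vs z∈ = ∨-zeroʳ _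

  joins-ends : ∀ {n} {x w : Fin n} p → joins x w p ≡ true → src p ≡ x × tgt p ≡ w
  joins-ends {x = x} {w} p eq with eqᵇ (src p) x in sx | eqᵇ (tgt p) w in tw
  ... | true | true = eqᵇ⇒≡ sx , eqᵇ⇒≡ tw

  Symmetric : {V : Set} → (V → V → Bool) → Set
  Symmetric adj = ∀ u v → adj u v ≡ adj v u

  module _ {V : Set} {adj : V → V → Bool} where

    walk-head : ∀ {x y vs} → Walk adj x y vs → x ∈ vs
    walk-head (single _) = here refl
    walk-head (step _ _) = here refl

    walk-last : ∀ {x y vs} → Walk adj x y vs → y ∈ vs
    walk-last (single _)   = here refl
    walk-last (step _ xy) = there (walk-last xy)

    walk-++ : ∀ {x y z w xs ys} → Walk adj x y xs → adj y z ≡ true → Walk adj z w ys → Walk adj x w (xs ++ ys)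
    walk-++ (single _)     yz zw = step yz zw
    walk-++ (step e xy)    yz zw = step e (walk-++ xy yz zw)

    walk-reverse : Symmetric adj → ∀ {x y vs} → Walk adj x y vs → Walk adj y x (reverse vs)
    walk-reverse sym-adj (single x) = single x
    walk-reverse sym-adj (step {u} {w} {vs = vs} uw wv) =
      subst (Walk adj _ u) (sym (unfold-reverse u vs))
            (walk-++ (walk-reverse sym-adj wv) (trans (sym-adj w u) uw) (single u))

  walk-map : {V V′ : Set} {adj : V → V → Bool} {adj′ : V′ → V′ → Bool} (f : V → V′) →
             (∀ {u v} → adj u v ≡ true → adj′ (f u) (f v) ≡ true) →
             ∀ {u v vs} → Walk adj u v vs → Walk adj′ (f u) (f v) (map f vs)
  walk-map f hom (single u) = single (f u)
  walk-map f hom (step e w) = step (hom e) (walk-map f hom w)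

  Unique-reverse : {A : Set} {xs : List A} → Unique xs → Unique (reverse xs)
  Unique-reverse {A} {xs} = Unique-resp-↭ (setoid A) (↭-sym (setoid A) (↭-reverse (setoid A) xs))

  module _ {n t : ℕ} (adj : Adj n) where

    blowAdj-lift : ∀ {u v} {i j : Fin t} → adj u v ≡ true → blowAdj adj (u , i) (v , j) ≡ true
    blowAdj-lift uv = cong (_∨ _) uv

    blowAdj-fibre : ∀ u {i j : Fin t} → i ≢ j → blowAdj adj (u , i) (u , j) ≡ true
    blowAdj-fibre u i≢j rewrite eqᵇ-refl u | ≢⇒eqᵇ≡false i≢j = ∨-zeroʳ (adj u u)

    blowAdj-sym : Symmetric adj → Symmetric (blowAdj {t = t} adj)
    blowAdj-sym sym-adj (u , i) (v , j) rewrite sym-adj u v | eqᵇ-sym u v | eqᵇ-sym i j = refl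

module Tracks where

  open import Data.Bool using (Bool; true)
  open import Data.Bool.Properties using (T-≡; T?)
  open import Data.Fin using (Fin; toℕ)
  open import Data.Fin.Properties using (toℕ-fromℕ<)
  open import Data.List using (List; []; _∷_; map; length; filterᵇ)
  open import Data.List.Membership.Propositional using (_∈_)
  open import Data.List.Membership.Propositional.Properties using (∈-map⁻; ∈-filter⁻; ∈-AllPairs₂)
  open import Data.List.Properties using (length-map)
  open import Data.List.Relation.Binary.Disjoint.Propositional using (Disjoint)
  open import Data.List.Relation.Unary.All as All using (All; []; _∷_)
  open import Data.List.Relation.Unary.AllPairs using (AllPairs; []; _∷_)
  import Data.List.Relation.Unary.AllPairs.Properties as AllPairsₚ
  open import Data.List.Relation.Unary.Any using (here; there)
  open import Data.List.Relation.Unary.Unique.Propositional using (Unique)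
  import Data.List.Relation.Unary.Unique.Propositional.Properties as Uniqueₚ
  open import Data.Nat using (ℕ; suc; _+_; _≤_; _<_; z<s; NonZero)
  open import Data.Nat.DivMod using (_mod_; m<n⇒m%n≡m)
  open import Data.Nat.Properties
  open import Data.Product using (∃; ∃₂; _×_; _,_; proj₁; proj₂)
  open import Data.Sum using (inj₁; inj₂)
  open import Function using (_∘_)
  open import Function.Bundles using (module Equivalence)
  open import Relation.Binary.PropositionalEquality
  open import Relation.Nullary using (contradiction)
  open import Defs
  open Lists
  open Graphs

  record TrackSystem {n : ℕ} (t : ℕ) (adj : Adj n) (Wl : List (Fin n)) (s L : ℕ) : Set where
    field
      track          : Fin n → Fin n → ℕ → List (Fin n × Fin t)
      track-path     : ∀ {x w ℓ} → x ∈ Wl → w ∈ Wl → ℓ < L →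
                       ∃₂ λ α β → IsPath (blowAdj adj) (x , α) (w , β) (track x w ℓ)
      track-high     : ∀ {x w ℓ y} → x ∈ Wl → w ∈ Wl → ℓ < L → y ∈ track x w ℓ → s ≤ toℕ (proj₂ y)
      track-disjoint : ∀ {x w ℓ x′ w′ ℓ′ y} → x ∈ Wl → w ∈ Wl → ℓ < L → x′ ∈ Wl → w′ ∈ Wl → ℓ′ < L →
                       y ∈ track x w ℓ → y ∈ track x′ w′ ℓ′ → x ≡ x′ × w ≡ w′ × ℓ ≡ ℓ′

  module _ {n t : ℕ} .{{_ : NonZero t}} (adj : Adj n) (s : ℕ) where

    private
      V : Set
      V = Fin n × Fin t

      -- The reduction mod t never bites: Room keeps every layer used below t.
      layer : ℕ → Fin t
      layer k = k mod t

      toℕ-layer : ∀ {k} → k < t → toℕ (layer k) ≡ k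
      toℕ-layer {k} k<t = trans (toℕ-fromℕ< _) (m<n⇒m%n≡m k<t)

    place : (Fin n → ℕ) → WPath n → List V
    place used p = map (λ z → z , layer (s + used z)) (verts p)

    after : (Fin n → ℕ) → WPath n → Fin n → ℕ
    after used p z = used z + ind (through z p)

    -- used z is the number of earlier paths through z, so each path goes just above the earlier ones.
    embed : (Fin n → ℕ) → List (WPath n) → List (WPath n × List V)
    embed used []       = []
    embed used (p ∷ ps) = (p , place used p) ∷ embed (after used p) ps

    Room : (Fin n → ℕ) → List (WPath n) → Set
    Room used ps = ∀ z → s + (used z + count (through z) ps) ≤ t

    room-after : ∀ used p ps → Room used (p ∷ ps) → Room (after used p) ps
    room-after used p ps room z = subst (λ k → s + k ≤ t) (sym (+-assoc (used z) _ _)) (room z)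

    place-layer : ∀ used p ps {y} → Room used (p ∷ ps) → y ∈ place used p →
                  toℕ (proj₂ y) ≡ s + used (proj₁ y)
    place-layer used p ps room y∈ with ∈-map⁻ _ y∈
    ... | z , z∈p , refl = toℕ-layer (begin-strict
      s + used z
        <⟨ +-monoʳ-< s (m<m+n (used z) z<s) ⟩
      s + (used z + (1 + count (through z) ps))
        ≡⟨ cong (λ b → s + (used z + (ind b + _))) (through-∈ {p = p} z∈p) ⟨
      s + (used z + count (through z) (p ∷ ps))
        ≤⟨ room z ⟩
      t
        ∎)
      where open ≤-Reasoning

    embed-above : ∀ used ps → Room used ps → ∀ {e y} → e ∈ embed used ps → y ∈ proj₂ e →
                  s + used (proj₁ y) ≤ toℕ (proj₂ y)
    embed-above used (p ∷ ps) room (here refl) y∈ = ≤-reflexive (sym (place-layer used p ps room y∈))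
    embed-above used (p ∷ ps) room (there e∈)  y∈ =
      ≤-trans (+-monoʳ-≤ s (m≤m+n (used _) _))
              (embed-above (after used p) ps (room-after used p ps room) e∈ y∈)

    embed-disjoint : ∀ used ps → Room used ps →
                     AllPairs (λ e e′ → Disjoint (proj₂ e) (proj₂ e′)) (embed used ps)
    embed-disjoint used []       room = []
    embed-disjoint used (p ∷ ps) room =
      All.tabulate later ∷ embed-disjoint (after used p) ps (room-after used p ps room)
      where
      later : ∀ {e} → e ∈ embed (after used p) ps → Disjoint (place used p) (proj₂ e)
      later e∈ (y∈p , y∈e) with ∈-map⁻ _ y∈p
      ... | z , z∈p , refl = 1+n≰n (begin
        suc (s + used z)                  ≡⟨ +-suc s (used z) ⟨
        s + suc (used z)                  ≡⟨ cong (s +_) (+-comm 1 (used z)) ⟩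
        s + (used z + 1)                  ≡⟨ cong (λ b → s + (used z + ind b)) (through-∈ {p = p} z∈p) ⟨
        s + after used p z                ≤⟨ embed-above (after used p) ps (room-after used p ps room) e∈ y∈e ⟩
        toℕ (layer (s + used z))          ≡⟨ place-layer used p ps room y∈p ⟩
        s + used z                        ∎)
        where open ≤-Reasoning

    embed-path : ∀ used ps → All (λ p → IsPath adj (src p) (tgt p) (verts p)) ps →
                 ∀ {e} → e ∈ embed used ps →
                 ∃₂ λ α β → IsPath (blowAdj adj) (src (proj₁ e) , α) (tgt (proj₁ e) , β) (proj₂ e)
    embed-path used (p ∷ ps) ((walk , walk!) ∷ _) (here refl) =
      _ , _ , walk-map _ (blowAdj-lift adj) walk , Uniqueₚ.map⁺ (cong proj₁) walk!
    embed-path used (p ∷ ps) (_ ∷ paths)          (there e∈)  = embed-path (after used p) ps paths e∈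

    count-embed : ∀ {used} (f : WPath n → Bool) ps → count (f ∘ proj₁) (embed used ps) ≡ count f ps
    count-embed f []       = refl
    count-embed f (p ∷ ps) = cong (ind (f p) +_) (count-embed f ps)

    module _ (G : List (WPath n)) (G-paths : All (λ p → IsPath adj (src p) (tgt p) (verts p)) G)
             (room : ∀ z → s + count (through z) G ≤ t) where

      private
        embedded : List (WPath n × List V)
        embedded = embed (λ _ → 0) G

        tracksOf : Fin n → Fin n → List (List V)
        tracksOf x w = map proj₂ (filterᵇ (joins x w ∘ proj₁) embedded)

        ∈-tracksOf : ∀ {x w T} → T ∈ tracksOf x w → ∃ λ p → (p , T) ∈ embedded × joins x w p ≡ true
        ∈-tracksOf {x} {w} T∈ with ∈-map⁻ proj₂ T∈
        ... | (p , T) , e∈ , refl with e∈embedded , joins-p ← ∈-filter⁻ (T? ∘ joins x w ∘ proj₁) e∈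
          = p , e∈embedded , Equivalence.to T-≡ joins-p

        length-tracksOf : ∀ x w → length (tracksOf x w) ≡ count (joins x w) G
        length-tracksOf x w = begin
          length (tracksOf x w)                          ≡⟨ length-map proj₂ (filterᵇ (joins x w ∘ proj₁) embedded) ⟩
          length (filterᵇ (joins x w ∘ proj₁) embedded)  ≡⟨ length-filterᵇ _ embedded ⟩
          count (joins x w ∘ proj₁) embedded             ≡⟨ count-embed (joins x w) G ⟩
          count (joins x w) G                            ∎
          where open ≡-Reasoning

        disjoint : AllPairs (λ e e′ → Disjoint (proj₂ e) (proj₂ e′)) embedded
        disjoint = embed-disjoint (λ _ → 0) G room

        tracksOf-unique : ∀ x w → Unique (tracksOf x w)
        tracksOf-unique x w =
          disjoint⇒Unique (AllPairsₚ.map⁺ (AllPairsₚ.filter⁺ _ disjoint)) (All.tabulate nonempty)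
          where
          nonempty : ∀ {T} → T ∈ tracksOf x w → ∃ (_∈ T)
          nonempty T∈ with p , e∈ , _ ← ∈-tracksOf T∈
                      with _ , _ , walk , _ ← embed-path (λ _ → 0) G G-paths e∈
            = _ , walk-head walk

      module _ (Wl : List (Fin n)) (L : ℕ)
               (enough : ∀ {x w} → x ∈ Wl → w ∈ Wl → L ≤ count (joins x w) G) where

        private
          track : Fin n → Fin n → ℕ → List V
          track x w ℓ = nthOr [] (tracksOf x w) ℓ

          in-range : ∀ {x w ℓ} → x ∈ Wl → w ∈ Wl → ℓ < L → ℓ < length (tracksOf x w)
          in-range {x} {w} x∈ w∈ ℓ<L =
            subst (_ <_) (sym (length-tracksOf x w)) (<-≤-trans ℓ<L (enough x∈ w∈))

          track-source : ∀ {x w ℓ} → x ∈ Wl → w ∈ Wl → ℓ < L →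
                         ∃ λ p → (p , track x w ℓ) ∈ embedded × src p ≡ x × tgt p ≡ w
          track-source x∈ w∈ ℓ<L with p , e∈ , joins-p ← ∈-tracksOf (nthOr-∈ [] _ (in-range x∈ w∈ ℓ<L))
            = p , e∈ , joins-ends p joins-p

        trackSystem : TrackSystem t adj Wl s L
        trackSystem = record
          { track          = track
          ; track-path     = path
          ; track-high     = high
          ; track-disjoint = disjoint-tracks
          }
          where
          path : ∀ {x w ℓ} → x ∈ Wl → w ∈ Wl → ℓ < L →
                 ∃₂ λ α β → IsPath (blowAdj adj) (x , α) (w , β) (track x w ℓ)
          path x∈ w∈ ℓ<L with p , e∈ , refl , refl ← track-source x∈ w∈ ℓ<L =
            embed-path (λ _ → 0) G G-paths e∈

          high : ∀ {x w ℓ y} → x ∈ Wl → w ∈ Wl → ℓ < L → y ∈ track x w ℓ → s ≤ toℕ (proj₂ y)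
          high x∈ w∈ ℓ<L y∈ with p , e∈ , _ ← track-source x∈ w∈ ℓ<L =
            ≤-trans (≤-reflexive (sym (+-identityʳ s))) (embed-above (λ _ → 0) G room e∈ y∈)

          disjoint-tracks : ∀ {x w ℓ x′ w′ ℓ′ y} → x ∈ Wl → w ∈ Wl → ℓ < L → x′ ∈ Wl → w′ ∈ Wl → ℓ′ < L →
                            y ∈ track x w ℓ → y ∈ track x′ w′ ℓ′ → x ≡ x′ × w ≡ w′ × ℓ ≡ ℓ′
          disjoint-tracks x∈ w∈ ℓ<L x′∈ w′∈ ℓ′<L y∈ y∈′
            with p , e∈ , sx , tw ← track-source x∈ w∈ ℓ<L
               | p′ , e′∈ , sx′ , tw′ ← track-source x′∈ w′∈ ℓ′<L
            with ∈-AllPairs₂ disjoint e∈ e′∈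
          ... | inj₂ (inj₁ disj) = contradiction (y∈ , y∈′) disj
          ... | inj₂ (inj₂ disj) = contradiction (y∈′ , y∈) disj
          ... | inj₁ same with refl ← trans (sym sx) (trans (cong (src ∘ proj₁) same) sx′)
                          | refl ← trans (sym tw) (trans (cong (tgt ∘ proj₁) same) tw′)
            = refl , refl , nthOr-injective [] (tracksOf-unique _ _) (in-range x∈ w∈ ℓ<L) (in-range x′∈ w′∈ ℓ′<L)
                                            (cong proj₂ same)

module Routing where

  open import Data.Bool using (_∧_)
  open import Data.Bool.Properties using (T-≡; T?)
  open import Data.Fin using (Fin; toℕ)
  open import Data.Fin.Properties using (_≟_)
  open import Data.List using (List; []; _∷_; _++_; map; concat; length; reverse; filterᵇ)
  open import Data.List.Membership.Propositional using (_∈_; _∉_; find)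
  open import Data.List.Membership.Propositional.Properties using (∈-++⁻; ∈-map⁺; ∈-filter⁻)
  open import Data.List.Properties using (length-map)
  open import Data.List.Relation.Binary.Disjoint.Propositional using (Disjoint)
  open import Data.List.Relation.Binary.Pointwise using (Pointwise; []; _∷_)
  open import Data.List.Relation.Binary.Subset.Propositional using (_⊆_)
  open import Data.List.Relation.Unary.All as All using (All; []; _∷_)
  open import Data.List.Relation.Unary.All.Properties using (¬Any⇒All¬)
  open import Data.List.Relation.Unary.AllPairs using ([]; _∷_)
  open import Data.List.Relation.Unary.Any using (here; there; any?)
  open import Data.List.Relation.Unary.Any.Properties using (reverse⁻)
  open import Data.List.Relation.Unary.Unique.Propositional using (Unique)
  import Data.List.Relation.Unary.Unique.Propositional.Properties as Uniqueₚ
  open import Data.Nat using (ℕ; suc; _+_; _*_; _≤_; _<_; _<?_; s≤s)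
  open import Data.Nat.Properties hiding (_≟_)
  open import Data.Nat.Solver using (module +-*-Solver)
  open import Data.Product using (∃; _×_; _,_; proj₁; proj₂)
  open import Data.Sum as Sum using (_⊎_; inj₁; inj₂)
  open import Function using (_∘_)
  open import Function.Bundles using (module Equivalence)
  open import Relation.Binary.PropositionalEquality
  open import Relation.Nullary using (¬_; yes; no; contradiction; _×-dec_)
  open import Defs
  open Lists
  open Graphs
  open Tracks using (TrackSystem)

  module _ {n t : ℕ} {adj : Adj n} (sym-adj : Symmetric adj) (s : ℕ) where

    private
      V : Set
      V = Fin n × Fin t

    High : V → Set
    High y = s ≤ toℕ (proj₂ y)

    low≢high : ∀ {i i′ : Fin t} → toℕ i < s → s ≤ toℕ i′ → i ≢ i′
    low≢high i<s s≤i′ refl = <⇒≱ i<s s≤i′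

    route : V → List V → List V → V → List V
    route a T₁ T₂ b = a ∷ T₁ ++ reverse T₂ ++ b ∷ []

    ∈-route-tail : ∀ (T₁ T₂ : List V) {b z} → z ∈ T₁ ++ reverse T₂ ++ b ∷ [] →
                   z ≡ b ⊎ z ∈ T₁ ⊎ z ∈ T₂
    ∈-route-tail T₁ T₂ z∈ with ∈-++⁻ T₁ z∈
    ... | inj₁ z∈T₁ = inj₂ (inj₁ z∈T₁)
    ... | inj₂ z∈′ with ∈-++⁻ (reverse T₂) z∈′
    ... | inj₁ z∈T₂       = inj₂ (inj₂ (reverse⁻ z∈T₂))
    ... | inj₂ (here z≡b) = inj₁ z≡b

    ∈-route : ∀ {a} (T₁ T₂ : List V) {b z} → z ∈ route a T₁ T₂ b →
              z ≡ a ⊎ z ≡ b ⊎ z ∈ T₁ ⊎ z ∈ T₂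
    ∈-route T₁ T₂ (here z≡a) = inj₁ z≡a
    ∈-route T₁ T₂ (there z∈) = inj₂ (∈-route-tail T₁ T₂ z∈)

    -- All three joints are edges inside a fibre; at the fibre of w the two track ends differ
    -- because T₁ and T₂ are disjoint.
    route-isPath : ∀ {u v w i j α β γ δ T₁ T₂} → toℕ i < s → toℕ j < s → (u , i) ≢ (v , j) →
                   IsPath (blowAdj adj) (u , α) (w , β) T₁ → IsPath (blowAdj adj) (v , γ) (w , δ) T₂ →
                   (∀ {y} → y ∈ T₁ → High y) → (∀ {y} → y ∈ T₂ → High y) → Disjoint T₁ T₂ →
                   IsPath (blowAdj adj) (u , i) (v , j) (route (u , i) T₁ T₂ (v , j))
    route-isPath {u} {v} {w} {i} {j} {α} {β} {γ} {δ} {T₁} {T₂}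
                 i<s j<s a≢b (walk₁ , T₁!) (walk₂ , T₂!) high₁ high₂ T₁#T₂ =
      step (blowAdj-fibre adj u (low≢high i<s (high₁ (walk-head walk₁))))
           (walk-++ walk₁ (blowAdj-fibre adj w β≢δ)
                    (walk-++ (walk-reverse (blowAdj-sym adj sym-adj) walk₂)
                             (blowAdj-fibre adj v (≢-sym (low≢high j<s (high₂ (walk-head walk₂)))))
                             (single (v , j))))
      , All.tabulate a∉tail ∷ Uniqueₚ.++⁺ T₁! (Uniqueₚ.++⁺ (Unique-reverse T₂!) ([] ∷ []) T₂#b) T₁#tail
      where
      β≢δ : β ≢ δ
      β≢δ refl = T₁#T₂ (walk-last walk₁ , walk-last walk₂)
      T₂#b : Disjoint (reverse T₂) ((v , j) ∷ [])
      T₂#b (y∈T₂ , here refl) = low≢high j<s (high₂ (reverse⁻ y∈T₂)) refl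
      T₁#tail : Disjoint T₁ (reverse T₂ ++ (v , j) ∷ [])
      T₁#tail (y∈T₁ , y∈tail) with ∈-++⁻ (reverse T₂) y∈tail
      ... | inj₁ y∈T₂        = T₁#T₂ (y∈T₁ , reverse⁻ y∈T₂)
      ... | inj₂ (here refl) = low≢high j<s (high₁ y∈T₁) refl
      a∉tail : ∀ {y} → y ∈ T₁ ++ reverse T₂ ++ (v , j) ∷ [] → (u , i) ≢ y
      a∉tail y∈ a≡y with ∈-route-tail T₁ T₂ y∈
      ... | inj₁ y≡b         = a≢b (trans a≡y y≡b)
      ... | inj₂ (inj₁ y∈T₁) = low≢high i<s (high₁ y∈T₁) (cong proj₂ a≡y)
      ... | inj₂ (inj₂ y∈T₂) = low≢high i<s (high₂ y∈T₂) (cong proj₂ a≡y)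

    module _ {Wl : List (Fin n)} (Wl! : Unique Wl) {L : ℕ} (tracks : TrackSystem t adj Wl s L)
             (2s<mL : 2 * s < length Wl * L)
             (lows : List (Fin t)) (lows<s : ∀ {i} → i ∈ lows → toℕ i < s) (|lows|≤s : length lows ≤ s)
             (X : List V) (X-low : ∀ {y} → y ∈ X → proj₁ y ∈ Wl × proj₂ y ∈ lows) where

      open TrackSystem tracks

      -- c x w counts the tracks from x to w used so far: those of index below c x w.
      Counter : Set
      Counter = Fin n → Fin n → ℕ

      used : Counter → Fin n → ℕ
      used c x = sumOver Wl (c x)

      bump : Counter → Fin n → Fin n → Counter
      bump c x₀ w₀ x w = ind (eqᵇ x₀ x ∧ eqᵇ w₀ w) + c x w

      next : Counter → Fin n → Fin n → Fin n → Counter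
      next c u v w = bump (bump c u w) v w

      ends : List (V × V) → List V
      ends M = concat (map (λ ab → proj₁ ab ∷ proj₂ ab ∷ []) M)

      typeCount : Fin n → List V → ℕ
      typeCount x = count (λ y → eqᵇ (proj₁ y) x)

      -- Every endpoint of type x still to be routed will use one more track starting at x.
      record Budget (c : Counter) (R : List (V × V)) : Set where
        constructor within
        field bound : ∀ x → used c x + typeCount x (ends R) ≤ s

      FreshTrack : Counter → V → Set
      FreshTrack c z = ∃ λ x → ∃ λ w → ∃ λ ℓ →
                       x ∈ Wl × w ∈ Wl × ℓ < L × c x w ≤ ℓ × z ∈ track x w ℓ

      record Linkage (c : Counter) (R : List (V × V)) : Set where
        field
          paths    : List (List V)
          linking  : Pointwise (λ ab vs → IsPath (blowAdj adj) (proj₁ ab) (proj₂ ab) vs) R paths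
          disjoint : Unique (concat paths)
          inside   : ∀ {z} → z ∈ concat paths → z ∈ ends R ⊎ FreshTrack c z

      used-bump : ∀ c x₀ w₀ x → used (bump c x₀ w₀) x ≤ ind (eqᵇ x₀ x) + used c x
      used-bump c x₀ w₀ x = begin
        used (bump c x₀ w₀) x
          ≡⟨ sumOver-+ Wl _ (c x) ⟩
        sumOver Wl (λ w → ind (eqᵇ x₀ x ∧ eqᵇ w₀ w)) + used c x
          ≤⟨ +-monoˡ-≤ (used c x) (sumOver-eqᵇ Wl! _ w₀) ⟩
        ind (eqᵇ x₀ x) + used c x
          ∎
        where open ≤-Reasoning

      bump-≥ : ∀ c x₀ w₀ x w → c x w ≤ bump c x₀ w₀ x w
      bump-≥ c x₀ w₀ x w = m≤n+m (c x w) _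

      bump-hit : ∀ c x₀ w₀ → bump c x₀ w₀ x₀ w₀ ≡ suc (c x₀ w₀)
      bump-hit c x₀ w₀ rewrite eqᵇ-refl x₀ | eqᵇ-refl w₀ = refl

      next-≥ : ∀ c u v w x w′ → c x w′ ≤ next c u v w x w′
      next-≥ c u v w x w′ = ≤-trans (bump-≥ c u w x w′) (bump-≥ (bump c u w) v w x w′)

      next-hitˡ : ∀ c u v w → c u w < next c u v w u w
      next-hitˡ c u v w = ≤-trans (≤-reflexive (sym (bump-hit c u w))) (bump-≥ (bump c u w) v w u w)

      next-hitʳ : ∀ c u v w → c v w < next c u v w v w
      next-hitʳ c u v w = ≤-trans (s≤s (bump-≥ c u w v w)) (≤-reflexive (sym (bump-hit (bump c u w) v w)))

      low : ∀ {y} → y ∈ X → toℕ (proj₂ y) < s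
      low y∈X = lows<s (proj₂ (X-low y∈X))

      fresh-high : ∀ {c z} → FreshTrack c z → High z
      fresh-high (x , w , ℓ , x∈ , w∈ , ℓ<L , _ , z∈) = track-high x∈ w∈ ℓ<L z∈

      fresh-antitone : ∀ {c c′ z} → (∀ x w → c x w ≤ c′ x w) → FreshTrack c′ z → FreshTrack c z
      fresh-antitone c≤c′ (x , w , ℓ , x∈ , w∈ , ℓ<L , c′≤ℓ , z∈) =
        x , w , ℓ , x∈ , w∈ , ℓ<L , ≤-trans (c≤c′ x w) c′≤ℓ , z∈

      spent-not-fresh : ∀ {c x w ℓ z} → x ∈ Wl → w ∈ Wl → ℓ < L → ℓ < c x w → z ∈ track x w ℓ →
                        ¬ FreshTrack c z
      spent-not-fresh x∈ w∈ ℓ<L ℓ<c z∈ (_ , _ , _ , x′∈ , w′∈ , ℓ′<L , c≤ℓ′ , z∈′)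
        with refl , refl , refl ← track-disjoint x∈ w∈ ℓ<L x′∈ w′∈ ℓ′<L z∈ z∈′ = <⇒≱ ℓ<c c≤ℓ′

      ends-⊆ : ∀ {R} → IsMatchingOn X R → ends R ⊆ X
      ends-⊆ {(a , b) ∷ R} ((_ , a∈X , b∈X) ∷ _ , _) (here refl)         = a∈X
      ends-⊆ {(a , b) ∷ R} ((_ , a∈X , b∈X) ∷ _ , _) (there (here refl)) = b∈X
      ends-⊆ {(a , b) ∷ R} (_ ∷ pairs , _ ∷ _ ∷ E!) (there (there y∈))   = ends-⊆ (pairs , E!) y∈

      matching-tail : ∀ {ab R} → IsMatchingOn X (ab ∷ R) → IsMatchingOn X R
      matching-tail (_ ∷ pairs , _ ∷ _ ∷ E!) = pairs , E!

      outside : ∀ {c R y} (linkage : Linkage c R) → y ∈ X → All (y ≢_) (ends R) →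
                ∀ {z} → z ∈ concat (Linkage.paths linkage) → y ≢ z
      outside linkage y∈X y∉E z∈ y≡z with Linkage.inside linkage z∈
      ... | inj₁ z∈E   = All.lookup y∉E z∈E y≡z
      ... | inj₂ fresh = low≢high (low y∈X) (fresh-high fresh) (cong proj₂ y≡z)

      spent-avoids : ∀ {c R x w ℓ z} (linkage : Linkage c R) → IsMatchingOn X R → x ∈ Wl → w ∈ Wl → ℓ < L →
                     ℓ < c x w → z ∈ track x w ℓ → z ∉ concat (Linkage.paths linkage)
      spent-avoids linkage match x∈ w∈ ℓ<L ℓ<c z∈T z∈ with Linkage.inside linkage z∈
      ... | inj₁ z∈E   = low≢high (low (ends-⊆ match z∈E)) (track-high x∈ w∈ ℓ<L z∈T) refl
      ... | inj₂ fresh = spent-not-fresh x∈ w∈ ℓ<L ℓ<c z∈T fresh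

      link-fibre : ∀ {c R u i j} → IsMatchingOn X (((u , i) , (u , j)) ∷ R) → Linkage c R →
                   Linkage c (((u , i) , (u , j)) ∷ R)
      link-fibre {u = u} {i} {j} ((a≢b , a∈X , b∈X) ∷ _ , (_ ∷ a∉E) ∷ b∉E ∷ _) linkage = record
        { paths    = ((u , i) ∷ (u , j) ∷ []) ∷ paths
        ; linking  = (step (blowAdj-fibre adj u (a≢b ∘ cong (u ,_))) (single (u , j)) , (a≢b ∷ []) ∷ [] ∷ [])
                     ∷ linking
        ; disjoint = (a≢b ∷ All.tabulate (outside linkage a∈X a∉E))
                     ∷ All.tabulate (outside linkage b∈X b∉E)
                     ∷ disjoint
        ; inside   = λ { (here refl) → inj₁ (here refl)
                       ; (there (here refl)) → inj₁ (there (here refl))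
                       ; (there (there z∈)) → Sum.map₁ (there ∘ there) (inside z∈) }
        }
        where open Linkage linkage

      via-isPath : ∀ {u v i j w ℓ₁ ℓ₂} → (u , i) ∈ X → (v , j) ∈ X → (u , i) ≢ (v , j) → u ≢ v →
                   w ∈ Wl → ℓ₁ < L → ℓ₂ < L →
                   IsPath (blowAdj adj) (u , i) (v , j) (route (u , i) (track u w ℓ₁) (track v w ℓ₂) (v , j))
      via-isPath {u} {v} a∈X b∈X a≢b u≢v w∈ ℓ₁<L ℓ₂<L =
        route-isPath (low a∈X) (low b∈X) a≢b
          (proj₂ (proj₂ (track-path u∈ w∈ ℓ₁<L))) (proj₂ (proj₂ (track-path v∈ w∈ ℓ₂<L)))
          (track-high u∈ w∈ ℓ₁<L) (track-high v∈ w∈ ℓ₂<L)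
          (λ (y∈T₁ , y∈T₂) → u≢v (proj₁ (track-disjoint u∈ w∈ ℓ₁<L v∈ w∈ ℓ₂<L y∈T₁ y∈T₂)))
        where
        u∈ : u ∈ Wl
        u∈ = proj₁ (X-low a∈X)
        v∈ : v ∈ Wl
        v∈ = proj₁ (X-low b∈X)

      link-via : ∀ {c R u v i j w} → IsMatchingOn X (((u , i) , (v , j)) ∷ R) → u ≢ v →
                 w ∈ Wl → c u w < L → c v w < L → Linkage (next c u v w) R →
                 Linkage c (((u , i) , (v , j)) ∷ R)
      link-via {c} {R} {u} {v} {i} {j} {w} match@((a≢b , a∈X , b∈X) ∷ _ , (_ ∷ a∉E) ∷ b∉E ∷ _)
               u≢v w∈ cu<L cv<L linkage = record
        { paths    = route (u , i) T₁ T₂ (v , j) ∷ paths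
        ; linking  = route-path ∷ linking
        ; disjoint = Uniqueₚ.++⁺ (proj₂ route-path) disjoint route#rest
        ; inside   = inside′
        }
        where
        open Linkage linkage
        u∈ : u ∈ Wl
        u∈ = proj₁ (X-low a∈X)
        v∈ : v ∈ Wl
        v∈ = proj₁ (X-low b∈X)
        T₁ T₂ : List V
        T₁ = track u w (c u w)
        T₂ = track v w (c v w)
        route-path : IsPath (blowAdj adj) (u , i) (v , j) (route (u , i) T₁ T₂ (v , j))
        route-path = via-isPath a∈X b∈X a≢b u≢v w∈ cu<L cv<L
        route#rest : Disjoint (route (u , i) T₁ T₂ (v , j)) (concat paths)
        route#rest (z∈route , z∈rest) with ∈-route T₁ T₂ z∈route
        ... | inj₁ refl               = outside linkage a∈X a∉E z∈rest refl
        ... | inj₂ (inj₁ refl)        = outside linkage b∈X b∉E z∈rest refl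
        ... | inj₂ (inj₂ (inj₁ z∈T₁)) =
          spent-avoids linkage (matching-tail match) u∈ w∈ cu<L (next-hitˡ c u v w) z∈T₁ z∈rest
        ... | inj₂ (inj₂ (inj₂ z∈T₂)) =
          spent-avoids linkage (matching-tail match) v∈ w∈ cv<L (next-hitʳ c u v w) z∈T₂ z∈rest
        inside′ : ∀ {z} → z ∈ route (u , i) T₁ T₂ (v , j) ++ concat paths →
                  z ∈ ends (((u , i) , (v , j)) ∷ R) ⊎ FreshTrack c z
        inside′ z∈ with ∈-++⁻ (route (u , i) T₁ T₂ (v , j)) z∈
        ... | inj₂ z∈rest  = Sum.map (there ∘ there) (fresh-antitone (next-≥ c u v w)) (inside z∈rest)
        ... | inj₁ z∈route with ∈-route T₁ T₂ z∈route
        ... | inj₁ refl               = inj₁ (here refl)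
        ... | inj₂ (inj₁ refl)        = inj₁ (there (here refl))
        ... | inj₂ (inj₂ (inj₁ z∈T₁)) = inj₂ (u , w , c u w , u∈ , w∈ , cu<L , ≤-refl , z∈T₁)
        ... | inj₂ (inj₂ (inj₂ z∈T₂)) = inj₂ (v , w , c v w , v∈ , w∈ , cv<L , ≤-refl , z∈T₂)

      budget-tail : ∀ {c ab R} → Budget c (ab ∷ R) → Budget c R
      budget-tail {c} {a , b} (within bound) = within λ x →
        ≤-trans (+-monoʳ-≤ (used c x) (≤-trans (m≤n+m _ (ind (eqᵇ (proj₁ b) x)))
                                               (m≤n+m _ (ind (eqᵇ (proj₁ a) x)))))
                (bound x)

      budget-next : ∀ {c R u v i j} w → Budget c (((u , i) , (v , j)) ∷ R) → Budget (next c u v w) R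
      budget-next {c} {R} {u} {v} {i} {j} w (within bound) = within λ x → begin
        used (next c u v w) x + typeCount x (ends R)
          ≤⟨ +-monoˡ-≤ _ (≤-trans (used-bump (bump c u w) v w x) (+-monoʳ-≤ _ (used-bump c u w x))) ⟩
        ind (eqᵇ v x) + (ind (eqᵇ u x) + used c x) + typeCount x (ends R)
          ≡⟨ solve 4 (λ a b c d → a :+ (b :+ c) :+ d := c :+ (b :+ (a :+ d))) refl
                     (ind (eqᵇ v x)) (ind (eqᵇ u x)) (used c x) (typeCount x (ends R)) ⟩
        used c x + typeCount x (ends (((u , i) , (v , j)) ∷ R))
          ≤⟨ bound x ⟩
        s ∎
        where
        open ≤-Reasoning
        open +-*-Solver

      -- If every colour were used up at u or at v, then |W| L ≤ used c u + used c v ≤ 2 s.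
      free-colour : ∀ {c R} → Budget c R → ∀ u v → ∃ λ w → w ∈ Wl × c u w < L × c v w < L
      free-colour {c} (within bound) u v with any? (λ w → (c u w <? L) ×-dec (c v w <? L)) Wl
      ... | yes some with w , w∈ , cu<L , cv<L ← find some = w , w∈ , cu<L , cv<L
      ... | no none = contradiction 2s<mL (≤⇒≯ (begin
        length Wl * L                     ≤⟨ length*≤sumOver Wl (saturated ∘ All.lookup (¬Any⇒All¬ Wl none)) ⟩
        sumOver Wl (λ w → c u w + c v w)  ≡⟨ sumOver-+ Wl (c u) (c v) ⟩
        used c u + used c v               ≤⟨ +-mono-≤ (used≤s u) (used≤s v) ⟩
        s + s                             ≡⟨ cong (s +_) (+-identityʳ s) ⟨
        2 * s                             ∎))
        where
        open ≤-Reasoning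
        used≤s : ∀ x → used c x ≤ s
        used≤s x = ≤-trans (m≤m+n _ _) (bound x)
        saturated : ∀ {w} → ¬ (c u w < L × c v w < L) → L ≤ c u w + c v w
        saturated {w} both with c u w <? L
        ... | no  cu≮L = ≤-trans (≮⇒≥ cu≮L) (m≤m+n _ _)
        ... | yes cu<L = ≤-trans (≮⇒≥ (λ cv<L → both (cu<L , cv<L))) (m≤n+m _ _)

      link : ∀ R c → Budget c R → IsMatchingOn X R → Linkage c R
      link [] c _ _ = record { paths = [] ; linking = [] ; disjoint = [] ; inside = λ () }
      link (((u , i) , (v , j)) ∷ R) c budget match with u ≟ v
      ... | yes refl = link-fibre match (link R c (budget-tail budget) (matching-tail match))
      ... | no u≢v with w , w∈ , cu<L , cv<L ← free-colour budget u v =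
        link-via match u≢v w∈ cu<L cv<L (link R (next c u v w) (budget-next w budget) (matching-tail match))

      typeCount≤s : ∀ {E} → Unique E → E ⊆ X → ∀ x → typeCount x E ≤ s
      typeCount≤s {E} E! E⊆X x = begin
        typeCount x E                               ≡⟨ length-filterᵇ _ E ⟨
        length (filterᵇ (λ y → eqᵇ (proj₁ y) x) E)  ≤⟨ Unique⇒length-mono-⊆ (Uniqueₚ.filter⁺ _ E!) typed⊆ ⟩
        length (map (x ,_) lows)                    ≡⟨ length-map (x ,_) lows ⟩
        length lows                                 ≤⟨ |lows|≤s ⟩
        s                                           ∎
        where
        open ≤-Reasoning
        typed⊆ : filterᵇ (λ y → eqᵇ (proj₁ y) x) E ⊆ map (x ,_) lows
        typed⊆ {x′ , i} y∈ with y∈E , typed ← ∈-filter⁻ (T? ∘ λ y → eqᵇ (proj₁ y) x) y∈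
          rewrite eqᵇ⇒≡ (Equivalence.to T-≡ typed) = ∈-map⁺ (x ,_) (proj₂ (X-low (E⊆X y∈E)))

      matchingLinked : Unique X → MatchingLinked (blowAdj adj) X
      matchingLinked X! = X! , λ M match →
        let open Linkage (link M (λ _ _ → 0) (budget₀ {M} match) match) in paths , linking , disjoint
        where
        budget₀ : ∀ {M} → IsMatchingOn X M → Budget (λ _ _ → 0) M
        budget₀ match@(_ , E!) = within λ x →
          subst (_≤ s) (sym (cong (_+ _) (sumOver-zero Wl))) (typeCount≤s E! (ends-⊆ match) x)

module Rationals where

  open import Data.Integer as ℤ using (ℤ; +_; -[1+_]; +≤+; +<+)
  import Data.Integer.Properties as ℤ
  open import Data.Nat as ℕ using (ℕ; suc; z≤n)
  open import Data.Nat.Coprimality using (1-coprimeTo; sym)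
  open import Data.Nat.DivMod using (m/n*n≡m; m/n*n≤m; n/n≡1)
  open import Data.Nat.Divisibility using (_∣_; ∣-refl)
  import Data.Nat.Properties as ℕ
  open import Data.Nat.Solver as ℕ-Solver using ()
  open import Data.Product using (∃; _×_; _,_)
  open import Data.Rational
  open import Data.Rational.Properties
  open import Data.Rational.Solver using (module +-*-Solver)
  open import Data.Rational.Unnormalised.Base as ℚᵘ using (ℚᵘ; mkℚᵘ; *≡*) renaming (_≃_ to _≃ᵘ_)
  import Data.Rational.Unnormalised.Properties as ℚᵘ
  open import Relation.Binary.PropositionalEquality hiding (sym)
  import Relation.Binary.PropositionalEquality as Eq

  fromℕ : ℕ → ℚ
  fromℕ n = + n / 1

  private
    fromℕ≡mkℚ : ∀ n → fromℕ n ≡ mkℚ (+ n) 0 (sym (1-coprimeTo n))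
    fromℕ≡mkℚ n = ↥p/↧p≡p (mkℚ (+ n) 0 (sym (1-coprimeTo n)))

    toℚᵘ-fromℕ : ∀ n → toℚᵘ (fromℕ n) ≃ᵘ mkℚᵘ (+ n) 0
    toℚᵘ-fromℕ n = toℚᵘ-fromℚᵘ (mkℚᵘ (+ n) 0)

  fromℕ-+ : ∀ a b → fromℕ (a ℕ.+ b) ≡ fromℕ a + fromℕ b
  fromℕ-+ a b rewrite fromℕ≡mkℚ a | fromℕ≡mkℚ b =
    /-cong {+ (a ℕ.+ b)} (cong₂ ℤ._+_ (Eq.sym (ℤ.*-identityʳ (+ a))) (Eq.sym (ℤ.*-identityʳ (+ b)))) refl

  fromℕ-* : ∀ a b → fromℕ (a ℕ.* b) ≡ fromℕ a * fromℕ b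
  fromℕ-* a b rewrite fromℕ≡mkℚ a | fromℕ≡mkℚ b = /-cong {+ (a ℕ.* b)} (ℤ.pos-* a b) refl

  fromℕ-mono-≤ : ∀ {a b} → a ℕ.≤ b → fromℕ a ≤ fromℕ b
  fromℕ-mono-≤ {a} {b} a≤b rewrite fromℕ≡mkℚ a | fromℕ≡mkℚ b =
    *≤* (subst₂ ℤ._≤_ (Eq.sym (ℤ.*-identityʳ (+ a))) (Eq.sym (ℤ.*-identityʳ (+ b))) (+≤+ a≤b))

  fromℕ-cancel-≤ : ∀ {a b} → fromℕ a ≤ fromℕ b → a ℕ.≤ b
  fromℕ-cancel-≤ {a} {b} fa≤fb rewrite fromℕ≡mkℚ a | fromℕ≡mkℚ b with drop-*≤* fa≤fb
  ... | a*1≤b*1 rewrite ℤ.*-identityʳ (+ a) | ℤ.*-identityʳ (+ b) = ℤ.drop‿+≤+ a*1≤b*1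

  fromℕ-mono-< : ∀ {a b} → a ℕ.< b → fromℕ a < fromℕ b
  fromℕ-mono-< {a} {b} a<b rewrite fromℕ≡mkℚ a | fromℕ≡mkℚ b =
    *<* (subst₂ ℤ._<_ (Eq.sym (ℤ.*-identityʳ (+ a))) (Eq.sym (ℤ.*-identityʳ (+ b))) (+<+ a<b))

  fromℕ-cancel-< : ∀ {a b} → fromℕ a < fromℕ b → a ℕ.< b
  fromℕ-cancel-< {a} {b} fa<fb rewrite fromℕ≡mkℚ a | fromℕ≡mkℚ b with drop-*<* fa<fb
  ... | a*1<b*1 rewrite ℤ.*-identityʳ (+ a) | ℤ.*-identityʳ (+ b) = ℤ.drop‿+<+ a*1<b*1

  fromℕ-nonNeg : ∀ n → NonNegative (fromℕ n)
  fromℕ-nonNeg n = nonNegative (fromℕ-mono-≤ {0} {n} z≤n)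

  fromℕ-*-/ : ∀ Q a d .{{_ : ℕ.NonZero d}} → d ∣ Q → fromℕ Q * (+ a / d) ≡ fromℕ (a ℕ.* (Q ℕ./ d))
  fromℕ-*-/ Q a d@(suc d-1) d∣Q = toℚᵘ-injective (begin
    toℚᵘ (fromℕ Q * (+ a / d))                ≈⟨ toℚᵘ-homo-* (fromℕ Q) (+ a / d) ⟩
    toℚᵘ (fromℕ Q) ℚᵘ.* toℚᵘ (+ a / d)        ≈⟨ ℚᵘ.*-cong (toℚᵘ-fromℕ Q) (toℚᵘ-fromℚᵘ _) ⟩
    mkℚᵘ (+ Q) 0 ℚᵘ.* mkℚᵘ (+ a) d-1          ≈⟨ *≡* ℤ-cleared ⟩
    mkℚᵘ (+ (a ℕ.* (Q ℕ./ d))) 0              ≈⟨ ℚᵘ.≃-sym (toℚᵘ-fromℕ (a ℕ.* (Q ℕ./ d))) ⟩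
    toℚᵘ (fromℕ (a ℕ.* (Q ℕ./ d)))            ∎)
    where
    open ℚᵘ.≃-Reasoning
    open ℕ-Solver.+-*-Solver
    cleared : Q ℕ.* a ℕ.* 1 ≡ a ℕ.* (Q ℕ./ d) ℕ.* (1 ℕ.* d)
    cleared = trans (cong (λ q → q ℕ.* a ℕ.* 1) (Eq.sym (m/n*n≡m d∣Q)))
                    (solve 3 (λ q d a → q :* d :* a :* con 1 := a :* q :* (con 1 :* d)) refl (Q ℕ./ d) d a)
    ℤ-cleared : (+ Q ℤ.* + a) ℤ.* + 1 ≡ + (a ℕ.* (Q ℕ./ d)) ℤ.* + (1 ℕ.* d)
    ℤ-cleared = trans (cong (ℤ._* + 1) (Eq.sym (ℤ.pos-* Q a)))
               (trans (Eq.sym (ℤ.pos-* (Q ℕ.* a) 1))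
               (trans (cong +_ cleared) (ℤ.pos-* (a ℕ.* (Q ℕ./ d)) (1 ℕ.* d))))

  floor-nonNeg : ∀ p → 0ℚ ≤ p → ∃ λ F → floor p ≡ + F × fromℕ F ≤ p
  floor-nonNeg (mkℚ (+ a) d-1 cop) _ = a ℕ./ suc d-1 , ℤ.*-identityˡ (+ (a ℕ./ suc d-1)) , below
    where
    below : fromℕ (a ℕ./ suc d-1) ≤ mkℚ (+ a) d-1 cop
    below rewrite fromℕ≡mkℚ (a ℕ./ suc d-1) =
      *≤* (subst₂ ℤ._≤_ (ℤ.pos-* (a ℕ./ suc d-1) (suc d-1)) (Eq.sym (ℤ.*-identityʳ (+ a)))
                        (+≤+ (m/n*n≤m a (suc d-1))))
  floor-nonNeg (mkℚ -[1+ a ] d-1 cop) (*≤* ())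

  scaled-bound : ∀ {F t Q K N d} {c e : ℚ} .{{_ : ℕ.NonZero d}} .{{_ : ℕ.NonZero Q}} .{{_ : ℕ.NonZero t}} →
                 fromℕ F ≤ c * fromℕ t → c < e * (+ N / d) → fromℕ Q * e ≤ fromℕ K →
                 d ℕ.* Q ℕ.* F ℕ.< K ℕ.* N ℕ.* t
  scaled-bound {F} {t} {Q} {K} {N} {d} {c} {e} F≤ct c<eN/d Qe≤K = fromℕ-cancel-< (begin-strict
    fromℕ (d ℕ.* Q ℕ.* F)
      ≡⟨ fromℕ-* (d ℕ.* Q) F ⟩
    fromℕ (d ℕ.* Q) * fromℕ F
      ≤⟨ *-monoˡ-≤-nonNeg (fromℕ (d ℕ.* Q)) {{fromℕ-nonNeg (d ℕ.* Q)}} F≤ct ⟩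
    fromℕ (d ℕ.* Q) * (c * fromℕ t)
      ≡⟨ solve 3 (λ a c t → a :* (c :* t) := a :* t :* c) refl (fromℕ (d ℕ.* Q)) c (fromℕ t) ⟩
    fromℕ (d ℕ.* Q) * fromℕ t * c
      ≡⟨ cong (_* c) (fromℕ-* (d ℕ.* Q) t) ⟨
    fromℕ dQt * c
      <⟨ *-monoʳ-<-pos (fromℕ dQt) {{positive (fromℕ-mono-< 0<dQt)}} c<eN/d ⟩
    fromℕ dQt * (e * (+ N / d))
      ≡⟨ cong (_* (e * (+ N / d))) (trans (fromℕ-* (d ℕ.* Q) t) (cong (_* fromℕ t) (fromℕ-* d Q))) ⟩
    fromℕ d * fromℕ Q * fromℕ t * (e * (+ N / d))
      ≡⟨ solve 5 (λ d q t e n → d :* q :* t :* (e :* n) := q :* e :* (d :* n :* t))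
               refl (fromℕ d) (fromℕ Q) (fromℕ t) e (+ N / d) ⟩
    fromℕ Q * e * (fromℕ d * (+ N / d) * fromℕ t)
      ≡⟨ cong (λ n → fromℕ Q * e * (n * fromℕ t)) d*N/d≡N ⟩
    fromℕ Q * e * (fromℕ N * fromℕ t)
      ≡⟨ cong (fromℕ Q * e *_) (fromℕ-* N t) ⟨
    fromℕ Q * e * fromℕ (N ℕ.* t)
      ≤⟨ *-monoʳ-≤-nonNeg (fromℕ (N ℕ.* t)) {{fromℕ-nonNeg (N ℕ.* t)}} Qe≤K ⟩
    fromℕ K * fromℕ (N ℕ.* t)
      ≡⟨ trans (cong fromℕ (ℕ.*-assoc K N t)) (fromℕ-* K (N ℕ.* t)) ⟨
    fromℕ (K ℕ.* N ℕ.* t)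
      ∎)
    where
    open ≤-Reasoning
    open +-*-Solver
    dQt : ℕ
    dQt = d ℕ.* Q ℕ.* t
    0<dQt : 0 ℕ.< dQt
    0<dQt = ℕ.>-nonZero⁻¹ dQt {{ℕ.m*n≢0 (d ℕ.* Q) t {{ℕ.m*n≢0 d Q}}}}
    d*N/d≡N : fromℕ d * (+ N / d) ≡ fromℕ N
    d*N/d≡N = trans (fromℕ-*-/ d N d ∣-refl) (cong fromℕ (trans (cong (N ℕ.*_) (n/n≡1 d)) (ℕ.*-identityʳ N)))

module Scaling where

  open import Data.Bool using (Bool; true; false)
  open import Data.Integer using (+_; -[1+_]; ∣_∣)
  open import Data.List using (List; []; _∷_; _++_; map; concatMap; replicate; filterᵇ)
  open import Data.List.Membership.Propositional using (_∈_)
  open import Data.List.Membership.Propositional.Properties using (∈-map⁺)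
  open import Data.List.Relation.Unary.All as All using (All; []; _∷_)
  import Data.List.Relation.Unary.All.Properties as Allₚ
  open import Data.List.Relation.Unary.Any using (here; there)
  open import Data.List.Relation.Unary.Unique.Propositional using (Unique)
  open import Data.Nat as ℕ using (ℕ; _+_; _*_; _≤_; z≤n; NonZero)
  open import Data.Nat.ListAction using (product)
  open import Data.Nat.ListAction.Properties using (∈⇒∣product; product≢0)
  open import Data.Nat.Properties
  open import Data.Nat.Solver using (module +-*-Solver)
  open import Data.Rational as ℚ using (ℚ; mkℚ; 0ℚ; 1ℚ; ↧ₙ_; *≤*)
  import Data.Rational.Properties as ℚ
  open import Function using (_∘_)
  open import Relation.Binary.PropositionalEquality
  open import Defs
  open Lists
  open Graphs
  open Rationals

  module _ {n : ℕ} (κ : WPath n → ℕ) where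

    mass : List (WPath n) → (WPath n → Bool) → ℕ
    mass xs f = sumOver xs (λ p → ind (f p) * κ p)

    copies : ℕ → List (WPath n) → List (WPath n)
    copies r = concatMap (λ p → replicate (r * κ p) p)

    count-copies : ∀ f r ys → count f (copies r ys) ≡ r * mass ys f
    count-copies f r []       = sym (*-zeroʳ r)
    count-copies f r (p ∷ ps) = begin
      count f (replicate (r * κ p) p ++ copies r ps)
        ≡⟨ count-++ f (replicate (r * κ p) p) _ ⟩
      count f (replicate (r * κ p) p) + count f (copies r ps)
        ≡⟨ cong₂ _+_ (count-replicate f _ p) (count-copies f r ps) ⟩
      ind (f p) * (r * κ p) + r * mass ps f
        ≡⟨ solve 4 (λ i r k m → i :* (r :* k) :+ r :* m := r :* (i :* k :+ m)) refl (ind (f p)) r (κ p) (mass ps f) ⟩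
      r * (ind (f p) * κ p + mass ps f)
        ∎
      where
      open ≡-Reasoning
      open +-*-Solver

    copies-All : ∀ {P : WPath n → Set} r {ys} → All P ys → All P (copies r ys)
    copies-All r []         = []
    copies-All r (Pp ∷ Pps) = Allₚ.++⁺ (Allₚ.replicate⁺ _ Pp) (copies-All r Pps)

    outflow≤mass : ∀ {xs} → (∀ {p} → p ∈ xs → src p ∈ verts p) → ∀ {ws} → Unique ws → ∀ x →
                   sumOver ws (λ w → mass xs (joins x w)) ≤ mass xs (through x)
    outflow≤mass {xs} src∈ {ws} ws! x = begin
      sumOver ws (λ w → sumOver xs (λ p → ind (joins x w p) * κ p))  ≡⟨ sumOver-swap ws xs _ ⟩
      sumOver xs (λ p → sumOver ws (λ w → ind (joins x w p) * κ p))  ≤⟨ sumOver-mono xs per-path ⟩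
      mass xs (through x)                                             ∎
      where
      open ≤-Reasoning
      src-through : ∀ {p} → p ∈ xs → ind (eqᵇ (src p) x) ≤ ind (through x p)
      src-through {p} p∈ with eqᵇ (src p) x in src≡x
      ... | false = z≤n
      ... | true rewrite through-∈ {p = p} (subst (_∈ verts p) (eqᵇ⇒≡ src≡x) (src∈ p∈)) = ≤-refl
      per-path : ∀ {p} → p ∈ xs → sumOver ws (λ w → ind (joins x w p) * κ p) ≤ ind (through x p) * κ p
      per-path {p} p∈ = begin
        sumOver ws (λ w → ind (joins x w p) * κ p)
          ≡⟨ sumOver-*ʳ ws (λ w → ind (joins x w p)) (κ p) ⟩
        sumOver ws (λ w → ind (joins x w p)) * κ p
          ≤⟨ *-monoˡ-≤ (κ p) (≤-trans (sumOver-eqᵇ ws! (eqᵇ (src p) x) (tgt p)) (src-through p∈)) ⟩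
        ind (through x p) * κ p
          ∎

  module _ {n : ℕ} (xs : List (WPath n)) (weights≥0 : All (λ p → 0ℚ ℚ.≤ weight p) xs) where

    scale : ℕ
    scale = product (map (↧ₙ_ ∘ weight) xs)

    scale≢0 : NonZero scale
    scale≢0 = product≢0 (Allₚ.map⁺ (All.universal (λ p → ↧ₙ≢0 (weight p)) xs))
      where
      ↧ₙ≢0 : ∀ q → NonZero (↧ₙ q)
      ↧ₙ≢0 q = _

    multiplicity : WPath n → ℕ
    multiplicity p = ∣ ℚ.↥ (weight p) ∣ * (scale ℕ./ ↧ₙ (weight p))

    multiplicity-scales : ∀ {p} → p ∈ xs → fromℕ (multiplicity p) ≡ fromℕ scale ℚ.* weight p
    multiplicity-scales {p} p∈
      with weight p | All.lookup weights≥0 p∈ | ∈⇒∣product (∈-map⁺ (↧ₙ_ ∘ weight) p∈)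
    ... | w@(mkℚ (+ a) _ _) | _ | d∣scale =
      sym (trans (cong (fromℕ scale ℚ.*_) (sym (ℚ.↥p/↧p≡p w))) (fromℕ-*-/ scale a (↧ₙ w) d∣scale))
    ... | mkℚ -[1+ _ ] _ _ | *≤* () | _

    mass-scales : ∀ f → fromℕ (mass multiplicity xs f) ≡ fromℕ scale ℚ.* sumℚ (map weight (filterᵇ f xs))
    mass-scales f = go xs (λ p∈ → p∈)
      where
      go : ∀ ys → (∀ {p} → p ∈ ys → p ∈ xs) →
           fromℕ (mass multiplicity ys f) ≡ fromℕ scale ℚ.* sumℚ (map weight (filterᵇ f ys))
      go []       _   = sym (ℚ.*-zeroʳ (fromℕ scale))
      go (y ∷ ys) ys⊆ with f y
      ... | false = go ys (ys⊆ ∘ there)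
      ... | true  = begin
        fromℕ (1 * multiplicity y + rest)
          ≡⟨ cong (λ k → fromℕ (k + rest)) (*-identityˡ (multiplicity y)) ⟩
        fromℕ (multiplicity y + rest)
          ≡⟨ fromℕ-+ (multiplicity y) rest ⟩
        fromℕ (multiplicity y) ℚ.+ fromℕ rest
          ≡⟨ cong₂ ℚ._+_ (multiplicity-scales (ys⊆ (here refl))) (go ys (ys⊆ ∘ there)) ⟩
        fromℕ scale ℚ.* weight y ℚ.+ fromℕ scale ℚ.* sumℚ (map weight (filterᵇ f ys))
          ≡⟨ ℚ.*-distribˡ-+ (fromℕ scale) (weight y) _ ⟨
        fromℕ scale ℚ.* sumℚ (map weight (y ∷ filterᵇ f ys))
          ∎
        where
        open ≡-Reasoning
        rest : ℕ
        rest = mass multiplicity ys f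

    mass-load : ∀ z → load xs z ℚ.≤ 1ℚ → mass multiplicity xs (through z) ≤ scale
    mass-load z load≤1 = fromℕ-cancel-≤ (begin
      fromℕ (mass multiplicity xs (through z))  ≡⟨ mass-scales (through z) ⟩
      fromℕ scale ℚ.* load xs z                 ≤⟨ ℚ.*-monoˡ-≤-nonNeg (fromℕ scale) {{fromℕ-nonNeg scale}} load≤1 ⟩
      fromℕ scale ℚ.* 1ℚ                        ≡⟨ ℚ.*-identityʳ (fromℕ scale) ⟩
      fromℕ scale                               ∎)
      where open ℚ.≤-Reasoning

    mass-flow : ∀ {e} x w → e ℚ.≤ flowBetween xs x w →
                fromℕ scale ℚ.* e ℚ.≤ fromℕ (mass multiplicity xs (joins x w))
    mass-flow {e} x w e≤flow = begin
      fromℕ scale ℚ.* e                         ≤⟨ ℚ.*-monoˡ-≤-nonNeg (fromℕ scale) {{fromℕ-nonNeg scale}} e≤flow ⟩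
      fromℕ scale ℚ.* flowBetween xs x w        ≡⟨ mass-scales (joins x w) ⟨
      fromℕ (mass multiplicity xs (joins x w))  ∎
      where open ℚ.≤-Reasoning

module Arithmetic where

  open import Data.Nat
  open import Data.Nat.DivMod using (m≡m%n+[m/n]*n; m%n<n; m/n*n≤m)
  open import Data.Nat.Properties
  open import Data.Nat.Solver using (module +-*-Solver)
  open import Relation.Binary.PropositionalEquality
  open import Relation.Nullary using (contradiction)
  open +-*-Solver
  open ≤-Reasoning

  private
    <-*-suc-/ : ∀ x d .{{_ : NonZero d}} → x < d * suc (x / d)
    <-*-suc-/ x d = begin-strict
      x                       ≡⟨ m≡m%n+[m/n]*n x d ⟩
      x % d + x / d * d       <⟨ +-monoˡ-< (x / d * d) (m%n<n x d) ⟩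
      d + x / d * d           ≡⟨ solve 2 (λ d q → d :+ q :* d := d :* (con 1 :+ q)) refl d (x / d) ⟩
      d * suc (x / d)         ∎

    *-suc-/-≤ : ∀ x d .{{_ : NonZero d}} → d * suc (x / d) ≤ x + d
    *-suc-/-≤ x d = begin
      d * suc (x / d)         ≡⟨ solve 2 (λ d q → d :* (con 1 :+ q) := q :* d :+ d) refl d (x / d) ⟩
      x / d * d + d           ≤⟨ +-monoˡ-≤ d (m/n*n≤m x d) ⟩
      x + d                   ∎

  -- Layers [0, s) carry the linked set, each ordered pair of W gets L tracks, and each path of the
  -- LP support is repeated r times its multiplicity.
  module Parameters (m Q t F : ℕ) .{{_ : NonZero m}} .{{_ : NonZero Q}}
                    (5Q+2≤t : 5 * Q + 2 ≤ t) (108F≤mt : 108 * F ≤ m * t) where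

    s L r : ℕ
    s = suc (F / m)
    L = suc (2 * s / m)
    r = (t ∸ s) / Q

    F≤ms : F ≤ m * s
    F≤ms = <⇒≤ (<-*-suc-/ F m)

    2s<mL : 2 * s < m * L
    2s<mL = <-*-suc-/ (2 * s) m

    108s≤t+108 : 108 * s ≤ t + 108
    108s≤t+108 = begin
      108 * s                 ≡⟨ *-suc 108 (F / m) ⟩
      108 + 108 * (F / m)     ≤⟨ +-monoʳ-≤ 108 (*-cancelˡ-≤ m m*[108[F/m]]≤m*t) ⟩
      108 + t                 ≡⟨ +-comm 108 t ⟩
      t + 108                 ∎
      where
      m*[108[F/m]]≤m*t : m * (108 * (F / m)) ≤ m * t
      m*[108[F/m]]≤m*t = begin
        m * (108 * (F / m))   ≡⟨ solve 2 (λ m q → m :* (con 108 :* q) := con 108 :* (q :* m)) refl m (F / m) ⟩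
        108 * (F / m * m)     ≤⟨ *-monoʳ-≤ 108 (m/n*n≤m F m) ⟩
        108 * F               ≤⟨ 108F≤mt ⟩
        m * t                 ∎

    s≤t : s ≤ t
    s≤t = *-cancelˡ-≤ 108 (begin
      108 * s                 ≤⟨ 108s≤t+108 ⟩
      t + 108                 ≤⟨ +-monoʳ-≤ t (*-monoʳ-≤ 54 (≤-trans (m≤n+m 2 (5 * Q)) 5Q+2≤t)) ⟩
      t + 54 * t              ≤⟨ +-monoʳ-≤ t (*-monoˡ-≤ t (m≤m+n 54 53)) ⟩
      t + 107 * t             ≡⟨ solve 1 (λ t → t :+ con 107 :* t := con 108 :* t) refl t ⟩
      108 * t                 ∎)

    s+rQ≤t : s + r * Q ≤ t
    s+rQ≤t = begin
      s + r * Q               ≤⟨ +-monoʳ-≤ s (m/n*n≤m (t ∸ s) Q) ⟩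
      s + (t ∸ s)             ≡⟨ m+[n∸m]≡n s≤t ⟩
      t                       ∎

    t<s+Q+rQ : t < s + (Q + r * Q)
    t<s+Q+rQ = begin-strict
      t                             ≡⟨ m+[n∸m]≡n s≤t ⟨
      s + (t ∸ s)                   ≡⟨ cong (s +_) (m≡m%n+[m/n]*n (t ∸ s) Q) ⟩
      s + ((t ∸ s) % Q + r * Q)     <⟨ +-monoʳ-< s (+-monoˡ-< (r * Q) (m%n<n (t ∸ s) Q)) ⟩
      s + (Q + r * Q)               ∎

    2t+324Q<108rQ : 2 * t + 324 * Q < 108 * (r * Q)
    2t+324Q<108rQ = +-cancelˡ-< (t + 108 + 108 * Q) _ _ (begin-strict
      t + 108 + 108 * Q + (2 * t + 324 * Q)
        ≡⟨ solve 2 (λ t Q → t :+ con 108 :+ con 108 :* Q :+ (con 2 :* t :+ con 324 :* Q)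
                         := con 3 :* t :+ (con 432 :* Q :+ con 108)) refl t Q ⟩
      3 * t + (432 * Q + 108)
        ≤⟨ +-monoʳ-≤ (3 * t) 432Q+108≤105t ⟩
      3 * t + 105 * t
        ≡⟨ solve 1 (λ t → con 3 :* t :+ con 105 :* t := con 108 :* t) refl t ⟩
      108 * t
        <⟨ *-monoʳ-< 108 t<s+Q+rQ ⟩
      108 * (s + (Q + r * Q))
        ≡⟨ solve 3 (λ s Q x → con 108 :* (s :+ (Q :+ x)) := con 108 :* s :+ con 108 :* Q :+ con 108 :* x)
                 refl s Q (r * Q) ⟩
      108 * s + 108 * Q + 108 * (r * Q)
        ≤⟨ +-monoˡ-≤ (108 * (r * Q)) (+-monoˡ-≤ (108 * Q) 108s≤t+108) ⟩
      t + 108 + 108 * Q + 108 * (r * Q)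
        ∎)
      where
      432Q+108≤105t : 432 * Q + 108 ≤ 105 * t
      432Q+108≤105t = begin
        432 * Q + 108        ≤⟨ +-mono-≤ (*-monoˡ-≤ Q (m≤m+n 432 93)) (m≤m+n 108 102) ⟩
        525 * Q + 210        ≡⟨ solve 1 (λ Q → con 525 :* Q :+ con 210 := con 105 :* (con 5 :* Q :+ con 2)) refl Q ⟩
        105 * (5 * Q + 2)    ≤⟨ *-monoʳ-≤ 105 5Q+2≤t ⟩
        105 * t              ∎

    108QL<2Kt+324Q : ∀ K → 108 * Q * F < K * (m * m) * t → 108 * Q * L < 2 * K * t + 324 * Q
    108QL<2Kt+324Q K 108QF<Km²t = *-cancelˡ-< (m * m) _ _ (begin-strict
      m * m * (108 * Q * L)
        ≡⟨ solve 3 (λ m Q L → m :* m :* (con 108 :* Q :* L) := con 108 :* Q :* m :* (m :* L)) refl m Q L ⟩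
      108 * Q * m * (m * L)
        ≤⟨ *-monoʳ-≤ (108 * Q * m) (*-suc-/-≤ (2 * s) m) ⟩
      108 * Q * m * (2 * s + m)
        ≡⟨ solve 3 (λ m Q s → con 108 :* Q :* m :* (con 2 :* s :+ m)
                           := con 2 :* (con 108 :* Q) :* (m :* s) :+ con 108 :* Q :* (m :* m)) refl m Q s ⟩
      2 * (108 * Q) * (m * s) + 108 * Q * (m * m)
        ≤⟨ +-monoˡ-≤ _ (*-monoʳ-≤ (2 * (108 * Q)) (*-suc-/-≤ F m)) ⟩
      2 * (108 * Q) * (F + m) + 108 * Q * (m * m)
        ≡⟨ solve 3 (λ m Q F → con 2 :* (con 108 :* Q) :* (F :+ m) :+ con 108 :* Q :* (m :* m)
                           := con 2 :* (con 108 :* Q :* F) :+ con 108 :* Q :* (con 2 :* m :+ m :* m)) refl m Q F ⟩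
      2 * (108 * Q * F) + 108 * Q * (2 * m + m * m)
        <⟨ +-mono-<-≤ (*-monoʳ-< 2 108QF<Km²t) (*-monoʳ-≤ (108 * Q) (+-monoˡ-≤ (m * m) (*-monoʳ-≤ 2 (m≤m*n m m)))) ⟩
      2 * (K * (m * m) * t) + 108 * Q * (2 * (m * m) + m * m)
        ≡⟨ solve 4 (λ m Q K t → con 2 :* (K :* (m :* m) :* t) :+ con 108 :* Q :* (con 2 :* (m :* m) :+ m :* m)
                             := m :* m :* (con 2 :* K :* t :+ con 324 :* Q)) refl m Q K t ⟩
      m * m * (2 * K * t + 324 * Q)
        ∎)

    L≤rK : ∀ K → 108 * Q * F < K * (m * m) * t → L ≤ r * K
    L≤rK zero      108QF<0    = contradiction 108QF<0 n≮0
    L≤rK K@(suc _) 108QF<Km²t = <⇒≤ (*-cancelˡ-< (108 * Q) L (r * K) (begin-strict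
      108 * Q * L
        <⟨ 108QL<2Kt+324Q K 108QF<Km²t ⟩
      2 * K * t + 324 * Q
        ≤⟨ +-monoʳ-≤ (2 * K * t) (m≤m*n (324 * Q) K) ⟩
      2 * K * t + 324 * Q * K
        ≡⟨ solve 3 (λ K t Q → con 2 :* K :* t :+ con 324 :* Q :* K := K :* (con 2 :* t :+ con 324 :* Q)) refl K t Q ⟩
      K * (2 * t + 324 * Q)
        ≤⟨ *-monoʳ-≤ K (<⇒≤ 2t+324Q<108rQ) ⟩
      K * (108 * (r * Q))
        ≡⟨ solve 3 (λ K r Q → K :* (con 108 :* (r :* Q)) := con 108 :* Q :* (r :* K)) refl K r Q ⟩
      108 * Q * (r * K)
        ∎))

module Subsets where

  open import Data.Bool using (true; false)
  open import Data.Fin using (Fin; zero; suc)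
  open import Data.Fin.Properties using (suc-injective)
  open import Data.Fin.Subset using (Subset; ∣_∣) renaming (_∈_ to _∈ₛ_)
  open import Data.List using (List; []; _∷_; map; length)
  open import Data.List.Membership.Propositional using (_∈_)
  open import Data.List.Membership.Propositional.Properties using (∈-map⁺; ∈-map⁻)
  open import Data.List.Properties using (length-map)
  open import Data.List.Relation.Unary.All as All using ()
  open import Data.List.Relation.Unary.AllPairs using ([]; _∷_)
  open import Data.List.Relation.Unary.Any using (here; there)
  open import Data.List.Relation.Unary.Unique.Propositional using (Unique)
  import Data.List.Relation.Unary.Unique.Propositional.Properties as Uniqueₚ
  open import Data.Nat using (suc)
  open import Data.Product using (_,_)
  open import Data.Vec using ([]; _∷_)
  open import Data.Vec.Base using (here; there)
  open import Relation.Binary.PropositionalEquality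

  elements : ∀ {n} → Subset n → List (Fin n)
  elements []          = []
  elements (true  ∷ p) = zero ∷ map suc (elements p)
  elements (false ∷ p) = map suc (elements p)

  length-elements : ∀ {n} (p : Subset n) → length (elements p) ≡ ∣ p ∣
  length-elements []          = refl
  length-elements (true  ∷ p) = cong suc (trans (length-map suc (elements p)) (length-elements p))
  length-elements (false ∷ p) = trans (length-map suc (elements p)) (length-elements p)

  elements⁻ : ∀ {n} (p : Subset n) {x} → x ∈ elements p → x ∈ₛ p
  elements⁻ (true  ∷ p) (here refl) = here
  elements⁻ (true  ∷ p) (there x∈) with y , y∈ , refl ← ∈-map⁻ suc x∈ = there (elements⁻ p y∈)
  elements⁻ (false ∷ p) x∈          with y , y∈ , refl ← ∈-map⁻ suc x∈ = there (elements⁻ p y∈)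

  elements⁺ : ∀ {n} (p : Subset n) {x} → x ∈ₛ p → x ∈ elements p
  elements⁺ (true  ∷ p) here      = here refl
  elements⁺ (true  ∷ p) (there x∈) = there (∈-map⁺ suc (elements⁺ p x∈))
  elements⁺ (false ∷ p) (there x∈) = ∈-map⁺ suc (elements⁺ p x∈)

  elements-unique : ∀ {n} (p : Subset n) → Unique (elements p)
  elements-unique []          = []
  elements-unique (true  ∷ p) = All.tabulate zero∉ ∷ Uniqueₚ.map⁺ suc-injective (elements-unique p)
    where
    zero∉ : ∀ {x} → x ∈ map suc (elements p) → zero ≢ x
    zero∉ x∈ refl with _ , _ , () ← ∈-map⁻ suc x∈
  elements-unique (false ∷ p) = Uniqueₚ.map⁺ suc-injective (elements-unique p)

module Construction where

  open import Data.Fin using (Fin; toℕ; inject≤)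
  open import Data.Fin.Properties using (toℕ<n; toℕ-inject≤; inject≤-injective)
  open import Data.List using (List; map; length; take; allFin; cartesianProduct)
  open import Data.List.Membership.Propositional using (_∈_)
  open import Data.List.Membership.Propositional.Properties using (∈-map⁻; ∈-cartesianProduct⁻)
  open import Data.List.Properties using (length-map; length-take; length-tabulate)
  open import Data.List.Relation.Unary.All as All using (All)
  open import Data.List.Relation.Unary.Unique.Propositional using (Unique)
  import Data.List.Relation.Unary.Unique.Propositional.Properties as Uniqueₚ
  open import Data.Nat
  open import Data.Nat.Properties
  open import Data.Nat.Solver using (module +-*-Solver)
  open import Data.Product using (∃; _×_; _,_; proj₁; proj₂)
  open import Function using (_∘_)
  open import Relation.Binary.PropositionalEquality
  open import Defs
  open Lists
  open Graphs
  open Tracks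
  open Routing
  open Scaling
  open Arithmetic

  module _ {t s : ℕ} (s≤t : s ≤ t) where

    lowLayers : List (Fin t)
    lowLayers = map (λ i → inject≤ i s≤t) (allFin s)

    lowLayers-< : ∀ {i} → i ∈ lowLayers → toℕ i < s
    lowLayers-< i∈ with j , _ , refl ← ∈-map⁻ _ i∈ = subst (_< _) (sym (toℕ-inject≤ j s≤t)) (toℕ<n j)

    length-lowLayers : length lowLayers ≡ s
    length-lowLayers = trans (length-map _ (allFin s)) (length-tabulate _)

    lowVertices : ∀ {n} {Wl : List (Fin n)} → Unique Wl → ∀ F → F ≤ length Wl * s →
                  ∃ λ (X : List (Fin n × Fin t)) →
                    Unique X × (∀ {y} → y ∈ X → proj₁ y ∈ Wl × proj₂ y ∈ lowLayers) × length X ≡ F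
    lowVertices {Wl = Wl} Wl! F F≤ms =
      take F (cartesianProduct Wl lowLayers)
      , Uniqueₚ.take⁺ F (Uniqueₚ.cartesianProduct⁺ Wl! (Uniqueₚ.map⁺ (inject≤-injective s≤t s≤t _ _)
                                                                  (Uniqueₚ.allFin⁺ s)))
      , ∈-cartesianProduct⁻ Wl lowLayers ∘ ∈-take⁻ F _
      , trans (length-take F _) (m≤n⇒m⊓n≡m (begin
          F                                       ≤⟨ F≤ms ⟩
          length Wl * s                           ≡⟨ cong (length Wl *_) length-lowLayers ⟨
          length Wl * length lowLayers            ≡⟨ length-cartesianProduct Wl lowLayers ⟨
          length (cartesianProduct Wl lowLayers)  ∎))
      where open ≤-Reasoning

  module _ {n : ℕ} {adj : Adj n} (sym-adj : Symmetric adj)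
           {Wl : List (Fin n)} (Wl! : Unique Wl) {x₀ : Fin n} (x₀∈ : x₀ ∈ Wl)
           {xs : List (WPath n)} (xs-paths : All (λ p → IsPath adj (src p) (tgt p) (verts p)) xs)
           (κ : WPath n → ℕ) (Q : ℕ) .{{_ : NonZero Q}} (load≤Q : ∀ z → mass κ xs (through z) ≤ Q) where

    private
      m : ℕ
      m = length Wl

      instance
        m≢0 : NonZero m
        m≢0 = ∈⇒length≢0 x₀∈

    108F≤mt : ∀ {t F} → (∀ {w} → w ∈ Wl → 108 * Q * F < mass κ xs (joins x₀ w) * (m * m) * t) →
              108 * F ≤ m * t
    108F≤mt {t} {F} flow = *-cancelˡ-≤ (Q * m) (begin
      Q * m * (108 * F)
        ≡⟨ solve 3 (λ Q m F → Q :* m :* (con 108 :* F) := m :* (con 108 :* Q :* F)) refl Q m F ⟩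
      m * (108 * Q * F)
        ≤⟨ length*≤sumOver Wl (λ {w} w∈ → ≤-trans (<⇒≤ (flow w∈)) (≤-reflexive (*-assoc (outflow w) (m * m) t))) ⟩
      sumOver Wl (λ w → outflow w * (m * m * t))
        ≡⟨ sumOver-*ʳ Wl outflow (m * m * t) ⟩
      sumOver Wl outflow * (m * m * t)
        ≤⟨ *-monoˡ-≤ (m * m * t) (≤-trans (outflow≤mass κ src∈ Wl! x₀) (load≤Q x₀)) ⟩
      Q * (m * m * t)
        ≡⟨ solve 3 (λ Q m t → Q :* (m :* m :* t) := Q :* m :* (m :* t)) refl Q m t ⟩
      Q * m * (m * t)
        ∎)
      where
      open ≤-Reasoning
      open +-*-Solver
      instance
        Qm≢0 : NonZero (Q * m)
        Qm≢0 = m*n≢0 Q m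
      outflow : Fin n → ℕ
      outflow w = mass κ xs (joins x₀ w)
      src∈ : ∀ {p} → p ∈ xs → src p ∈ verts p
      src∈ = walk-head ∘ proj₁ ∘ All.lookup xs-paths

    linkedSet : ∀ {t F} → 5 * Q + 2 ≤ t →
                (∀ {x w} → x ∈ Wl → w ∈ Wl → 108 * Q * F < mass κ xs (joins x w) * (m * m) * t) →
                ∃ λ (X : List (Fin n × Fin t)) → MatchingLinked (blowAdj adj) X × length X ≡ F
    linkedSet {t} {F} 5Q+2≤t flow =
      let X , X! , X-low , |X|≡F = lowVertices s≤t Wl! F F≤ms in
      X , matchingLinked sym-adj s Wl! tracks 2s<mL
                         (lowLayers s≤t) (lowLayers-< s≤t) (≤-reflexive (length-lowLayers s≤t)) X X-low X!
        , |X|≡F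
      where
      open Parameters m Q t F 5Q+2≤t (108F≤mt (flow x₀∈))
      open ≤-Reasoning
      instance
        t≢0 : NonZero t
        t≢0 = >-nonZero (≤-trans (s≤s z≤n) (≤-trans (m≤n+m 2 (5 * Q)) 5Q+2≤t))
      G : List (WPath n)
      G = copies κ r xs
      room : ∀ z → s + count (through z) G ≤ t
      room z = begin
        s + count (through z) G        ≡⟨ cong (s +_) (count-copies κ (through z) r xs) ⟩
        s + r * mass κ xs (through z)  ≤⟨ +-monoʳ-≤ s (*-monoʳ-≤ r (load≤Q z)) ⟩
        s + r * Q                      ≤⟨ s+rQ≤t ⟩
        t                              ∎
      enough : ∀ {x w} → x ∈ Wl → w ∈ Wl → L ≤ count (joins x w) G
      enough x∈ w∈ = subst (L ≤_) (sym (count-copies κ _ r xs)) (L≤rK _ (flow x∈ w∈))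
      tracks : TrackSystem t adj Wl s L
      tracks = trackSystem adj s G (copies-All κ r xs-paths) room Wl L enough

open import Defs
open import Data.Fin using (Fin)
open import Data.Fin.Subset using (Subset; Nonempty; ∣_∣)
open import Data.Integer using (+_)
open import Data.List using (List; length)
open import Data.List.Membership.Propositional using (_∈_)
import Data.List.Relation.Unary.All as All
open import Data.Nat using (ℕ; _≥_)
import Data.Nat as ℕ
import Data.Nat.Properties as ℕₚ
open import Data.Product using (Σ; _×_; _,_; proj₁; proj₂)
open import Data.Rational using (ℚ; 0ℚ; _<_; _≤_; _*_; _/_; floor; nonNegative)
import Data.Rational.Properties as ℚ
open import Function using (_∘_)
open import Relation.Binary.PropositionalEquality using (_≡_; cong; sym; trans)
open Graphs using (joins)
open Rationals using (fromℕ; fromℕ-nonNeg; floor-nonNeg; scaled-bound)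
open Scaling using (mass; scale; scale≢0; multiplicity; mass-load; mass-flow)
open Subsets using (elements; elements⁺; elements⁻; elements-unique; length-elements)
open Construction using (linkedSet)

theorem36 : (n : ℕ) (adj : Adj n) → IsSimple adj →
    (W : Subset n) → Nonempty W →
    (xs : List (WPath n)) (e : ℚ) → Feasible adj W xs e →
    (c : ℚ) → 0ℚ < c → c < e * ((+ (∣ W ∣ Data.Nat.* ∣ W ∣)) / 108) →
    Σ ℕ λ T → (t : ℕ) → t ≥ T →
      Σ (List (Fin n × Fin t)) λ X →
        MatchingLinked (blowAdj adj) X × + (length X) ≡ floor (c * ((+ t) / 1))
theorem36 n adj (sym-adj , _) W (x₀ , x₀∈W) xs e (xs-ok , _ , flow , load) c 0<c c<e|W|²/108 =
  5 ℕ.* Q ℕ.+ 2 , λ t 5Q+2≤t →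
    let F , floor≡F , F≤ct = floor-nonNeg (c * fromℕ t) (0≤ct t)
        X , linked , |X|≡F = linkedSet sym-adj (elements-unique W) (elements⁺ W x₀∈W) (All.map proj₁ xs-ok)
                               κ Q {{scale≢0 xs weights≥0}} (λ z → mass-load xs weights≥0 z (load z))
                               5Q+2≤t (flow-bound t 5Q+2≤t F≤ct)
    in X , linked , trans (cong +_ |X|≡F) (sym floor≡F)
  where
  weights≥0 : All.All (λ p → 0ℚ ≤ weight p) xs
  weights≥0 = All.map (proj₂ ∘ proj₂ ∘ proj₂) xs-ok
  Q : ℕ
  Q = scale xs weights≥0
  κ : WPath n → ℕ
  κ = multiplicity xs weights≥0
  0≤ct : ∀ t → 0ℚ ≤ c * fromℕ t
  0≤ct t = ℚ.nonNegative⁻¹ _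
    {{ℚ.nonNeg*nonNeg⇒nonNeg c {{nonNegative (ℚ.<⇒≤ 0<c)}} (fromℕ t) {{fromℕ-nonNeg t}}}}
  flow-bound : ∀ t {F} → 5 ℕ.* Q ℕ.+ 2 ℕ.≤ t → fromℕ F ≤ c * fromℕ t →
               ∀ {x w} → x ∈ elements W → w ∈ elements W →
               108 ℕ.* Q ℕ.* F ℕ.< mass κ xs (joins x w) ℕ.* (length (elements W) ℕ.* length (elements W)) ℕ.* t
  flow-bound t {F} 5Q+2≤t F≤ct {x} {w} x∈ w∈ rewrite length-elements W =
    scaled-bound {F} {t} {Q} {mass κ xs (joins x w)} {∣ W ∣ ℕ.* ∣ W ∣} {108}
                 {{_}} {{scale≢0 xs weights≥0}} {{t≢0}}
                 F≤ct c<e|W|²/108 (mass-flow xs weights≥0 x w (flow x w (elements⁻ W x∈) (elements⁻ W w∈)))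
    where
    t≢0 : ℕ.NonZero t
    t≢0 = ℕ.>-nonZero (ℕₚ.≤-trans (ℕ.s≤s ℕ.z≤n) (ℕₚ.≤-trans (ℕₚ.m≤n+m 2 _) 5Q+2≤t))
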